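{- Let $a,b$ be positive integers with $a$ odd, and let $|q|<1$. If $b$ is even, then $$\sum_{n=0}^{\infty}N(a,3a,4b;8n+5a)q^n=4q^a\psi(q^a)\psi(q^{12a})\varphi(q^{b/2}),\qquad \sum_{n=0}^{\infty}N(a,3a,4b;8n+7a)q^n=4\psi(q^{3a})\psi(q^{4a})\varphi(q^{b/2}).$$ If $b$ is odd, then $$\begin{aligned}\sum_{n=0}^{\infty}N(a,3a,4b;8n)q^n&=\varphi(q^{2a})\varphi(q^{6a})\varphi(q^{2b})+4q^{2a}\psi(q^{4a})\psi(q^{12a})\varphi(q^{2b})\\&\quad+12q^{(a+b)/2}\big(\varphi(q^{6a})\psi(q^{4a})+q^a\varphi(q^{2a})\psi(q^{12a})\big)\psi(q^{4b}),\end{aligned}$$ $$\begin{aligned}\sum_{n=0}^{\infty}N(a,3a,4b;8n+4)q^n&=2q^{(b-1)/2}\varphi(q^{2a})\varphi(q^{6a})\psi(q^{4b})+8q^{2a+(b-1)/2}\psi(q^{4a})\psi(q^{12a})\psi(q^{4b})\\&\quad+6q^{(a-1)/2}\big(\varphi(q^{6a})\psi(q^{4a})+q^a\varphi(q^{2a})\psi(q^{12a})\big)\varphi(q^{2b}).\end{aligned}$$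
   Context: For positive integers $a,b,c$ and $n\in\mathbb{N}=\{0,1,2,\dots\}$, $N(a,b,c;n)$ denotes the number of triples $(x,y,z)\in\mathbb{Z}^3$ with $n=ax^2+by^2+cz^2$. Ramanujan's theta functions are $\varphi(q)=\sum_{n=-\infty}^{\infty}q^{n^2}$ and $\psi(q)=\sum_{n=0}^{\infty}q^{n(n+1)/2}$ for $|q|<1$. -}

module Defs where

open import Data.Nat using (ℕ; zero; suc; _+_; _*_; _∸_; _≟_)
open import Data.Nat.DivMod using (_/_)
open import Data.Integer as ℤ using (ℤ; +_)
open import Data.List using (List; map; upTo)
open import Data.Nat.ListAction using (sum)
open import Relation.Nullary using (Dec; yes; no)

-- Formal power series in q with natural-number coefficients,
-- represented by their coefficient function: f n = [q^n] f.
Series : Set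
Series = ℕ → ℕ

sumTo : (ℕ → ℕ) → ℕ → ℕ
sumTo f zero = f zero
sumTo f (suc n) = sumTo f n + f (suc n)

infixl 7 _⊛_
_⊛_ : Series → Series → Series
(f ⊛ g) n = sumTo (λ i → f i * g (n ∸ i)) n

infixl 6 _⊕_
_⊕_ : Series → Series → Series
(f ⊕ g) n = f n + g n

infixl 8 _·_
_·_ : ℕ → Series → Series
(k · f) n = k * f n

qpow : ℕ → Series → Series
qpow zero f = f
qpow (suc k) f zero = 0
qpow (suc k) f (suc n) = qpow k f n

ind : {P : Set} → Dec P → ℕ
ind (yes _) = 1
ind (no _) = 0

intRange : ℕ → List ℤ
intRange B = map (λ i → (+ i) ℤ.- (+ B)) (upTo (suc (B + B)))

sumZ : ℕ → (ℤ → ℕ) → ℕ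
sumZ B f = sum (map f (intRange B))

-- N(a,b,c;n) = #{(x,y,z) ∈ ℤ³ : n = a x² + b y² + c z²}.
-- For a,b,c ≥ 1 every solution has |x|,|y|,|z| ≤ n, so the box count is exact.
N : ℕ → ℕ → ℕ → ℕ → ℕ
N a b c n =
  sumZ n λ x → sumZ n λ y → sumZ n λ z →
    ind ((+ a) ℤ.* x ℤ.* x ℤ.+ (+ b) ℤ.* y ℤ.* y ℤ.+ (+ c) ℤ.* z ℤ.* z ℤ.≟ (+ n))

-- φ(q^k) = Σ_{m ∈ ℤ} q^{k m²}; coefficient of q^n (exact for k ≥ 1).
phi : ℕ → Series
phi k n = sumZ n λ m → ind ((+ k) ℤ.* m ℤ.* m ℤ.≟ (+ n))

-- ψ(q^k) = Σ_{m ≥ 0} q^{k m(m+1)/2}; coefficient of q^n (exact for k ≥ 1).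
psi : ℕ → Series
psi k n = sum (map (λ m → ind (k * ((m * suc m) / 2) ≟ n)) (upTo (suc n)))

module Submission where

-- The proof is a direct count.  Every coefficient on the right is a finite
-- count: [q^m] φ(q^k) counts x ∈ ℤ with k x² = m, [q^m] ψ(q^k) counts x ∈ ℤ
-- with k·tri x = m twice (tri j = tri (-1 - j) = j(j + 1)/2), products of
-- series count tuples with the weights added, and q^c adds c to the weight
-- (Counts).  On the left, N(a, 3a, 4b; M) is a sum over a box in ℤ³, which is
-- split by the classes of x and y modulo 4 and of z modulo 2 ("leaves").  The
-- pairs with x, y both odd are traded for the pairs with x ≡ 2, y ≡ 0 or
-- x ≡ 0, y ≡ 2 (mod 4) by changes of variables preserving x² + 3y²
-- (OddPairs); this is the source of the coefficients 3 and 12.  In each leaf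
-- the weight is an explicit polynomial in the squares and triangular numbers of
-- the new variables: either it can never equal M, by a parity argument, or the
-- leaf counts exactly the tuples behind one theta product.

open import Defs
open import Data.Nat using (ℕ; suc; _+_; _*_; _∸_; _≤_)
open import Data.Nat.DivMod using (_/_)
open import Data.Nat.Divisibility using (_∣_)
open import Data.Product using (_×_)
open import Relation.Nullary using (¬_)
open import Relation.Binary.PropositionalEquality using (_≡_)

open import Data.Nat as ℕ using (zero; _<_; z≤n; s≤s; _≟_; _≤?_)
import Data.Nat.Properties as ℕP
open import Data.Nat.DivMod using (m*n/n≡m)
open import Data.Nat.Divisibility using (divides)
open import Data.Nat.Tactic.RingSolver using (solve; solve-∀)
open import Data.Integer as ℤ using (ℤ; +_; -[1+_]; ∣_∣)
import Data.Integer.Properties as ℤP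
import Data.Integer.Tactic.RingSolver as ℤSolver
open import Data.List using (_∷_; []; map; applyUpTo)
open import Data.Nat.ListAction using (sum)
open import Data.Product using (Σ; _,_; proj₁; proj₂)
open import Data.Sum using (_⊎_; inj₁; inj₂)
open import Data.Empty using (⊥-elim)
open import Relation.Nullary using (Dec; yes; no)
open import Relation.Nullary.Decidable using (decidable-stable)
open import Relation.Binary.PropositionalEquality
  using (_≢_; refl; sym; trans; cong; cong₂; subst; module ≡-Reasoning)
open import Function using (_∘_; id)

sumF : (ℕ → ℕ) → ℕ → ℕ
sumF f zero = 0
sumF f (suc n) = f 0 + sumF (f ∘ suc) n

sumF-cong : ∀ {f g} n → (∀ i → f i ≡ g i) → sumF f n ≡ sumF g n
sumF-cong zero e = refl
sumF-cong (suc n) e = cong₂ _+_ (e 0) (sumF-cong n (λ i → e (suc i)))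

sumF-snoc : ∀ f n → sumF f (suc n) ≡ sumF f n + f n
sumF-snoc f zero = ℕP.+-comm (f 0) 0
sumF-snoc f (suc n) =
  trans (cong (_+_ (f 0)) (sumF-snoc (f ∘ suc) n)) (sym (ℕP.+-assoc (f 0) _ _))

sumF-stable : ∀ f n d → (∀ j → n ≤ j → f j ≡ 0) → sumF f (n + d) ≡ sumF f n
sumF-stable f n zero z = cong (sumF f) (ℕP.+-identityʳ n)
sumF-stable f n (suc d) z rewrite ℕP.+-suc n d =
  trans (sumF-snoc f (n + d))
    (trans (cong₂ _+_ (sumF-stable f n d z) (z (n + d) (ℕP.m≤m+n n d))) (ℕP.+-identityʳ _))

map-applyUpTo : ∀ {A B : Set} (k : A → B) (h : ℕ → A) n →
                map k (applyUpTo h n) ≡ applyUpTo (k ∘ h) n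
map-applyUpTo k h zero = refl
map-applyUpTo k h (suc n) = cong (k (h 0) ∷_) (map-applyUpTo k (h ∘ suc) n)

sum-applyUpTo : ∀ h n → sum (applyUpTo h n) ≡ sumF h n
sum-applyUpTo h zero = refl
sum-applyUpTo h (suc n) = cong (_+_ (h 0)) (sum-applyUpTo (h ∘ suc) n)

-- Σz B f = Σ_{|x| ≤ B} f x, the symmetric box sum over ℤ, built from the
-- outside in so that induction on B adds the two new endpoints.
Σz : ℕ → (ℤ → ℕ) → ℕ
Σz zero f = f (+ 0)
Σz (suc B) f = f -[1+ B ] + Σz B f + f (+ suc B)

sumZ≡Σz : ∀ B f → sumZ B f ≡ Σz B f
sumZ≡Σz B f = begin
    sum (map f (map (λ i → + i ℤ.- + B) (applyUpTo id (suc (B + B)))))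
  ≡⟨ cong (sum ∘ map f) (map-applyUpTo _ id (suc (B + B))) ⟩
    sum (map f (applyUpTo (λ i → + i ℤ.- + B) (suc (B + B))))
  ≡⟨ cong sum (map-applyUpTo f (λ i → + i ℤ.- + B) (suc (B + B))) ⟩
    sum (applyUpTo (λ i → f (+ i ℤ.- + B)) (suc (B + B)))
  ≡⟨ sum-applyUpTo (λ i → f (+ i ℤ.- + B)) (suc (B + B)) ⟩
    sumF (λ i → f (+ i ℤ.- + B)) (suc (B + B))
  ≡⟨ enumerate B f ⟩
    Σz B f ∎
  where
  open ≡-Reasoning
  shift : ∀ i B → + suc i ℤ.- + suc B ≡ + i ℤ.- + B
  shift i B = lemma (+ i) (+ B)
    where lemma : ∀ a b → (ℤ.+ 1 ℤ.+ a) ℤ.- (ℤ.+ 1 ℤ.+ b) ≡ a ℤ.- b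
          lemma = ℤSolver.solve-∀
  right-end : ∀ B → + (suc B + suc B) ℤ.- + suc B ≡ + suc B
  right-end B = lemma (+ suc B)
    where lemma : ∀ a → (a ℤ.+ a) ℤ.- a ≡ a
          lemma = ℤSolver.solve-∀
  enumerate : ∀ B (f : ℤ → ℕ) → sumF (λ i → f (+ i ℤ.- + B)) (suc (B + B)) ≡ Σz B f
  enumerate zero f = ℕP.+-identityʳ _
  enumerate (suc B) f = begin
      sumF g (suc (suc B + suc B))
    ≡⟨ sumF-snoc g (suc B + suc B) ⟩
      sumF g (suc B + suc B) + g (suc B + suc B)
    ≡⟨ cong (λ k → sumF g k + g (suc B + suc B)) (cong suc (ℕP.+-suc B B)) ⟩
      g 0 + sumF (g ∘ suc) (suc (B + B)) + g (suc B + suc B)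
    ≡⟨ cong₂ _+_ (cong₂ _+_ (cong f (ℤP.+-identityˡ -[1+ B ]))
          (trans (sumF-cong (suc (B + B)) (λ i → cong f (shift i B))) (enumerate B f)))
          (cong f (right-end B)) ⟩
      f -[1+ B ] + Σz B f + f (+ suc B) ∎
    where
    g : ℕ → ℕ
    g i = f (+ i ℤ.- + suc B)

Σz-cong : ∀ B {f g : ℤ → ℕ} → (∀ x → f x ≡ g x) → Σz B f ≡ Σz B g
Σz-cong zero e = e _
Σz-cong (suc B) e = cong₂ _+_ (cong₂ _+_ (e _) (Σz-cong B e)) (e _)

Σz-+ : ∀ B (f g : ℤ → ℕ) → Σz B (λ x → f x + g x) ≡ Σz B f + Σz B g
Σz-+ zero f g = refl
Σz-+ (suc B) f g =
  trans (cong (λ k → f -[1+ B ] + g -[1+ B ] + k + (f (+ suc B) + g (+ suc B))) (Σz-+ B f g))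
        (regroup (f -[1+ B ]) (g -[1+ B ]) (Σz B f) (Σz B g) (f (+ suc B)) (g (+ suc B)))
  where regroup : ∀ a b c d e h → a + b + (c + d) + (e + h) ≡ a + c + e + (b + d + h)
        regroup = solve-∀

Σz-*ˡ : ∀ B c (f : ℤ → ℕ) → Σz B (λ x → c * f x) ≡ c * Σz B f
Σz-*ˡ zero c f = refl
Σz-*ˡ (suc B) c f =
  trans (cong (λ k → c * f -[1+ B ] + k + c * f (+ suc B)) (Σz-*ˡ B c f))
        (distrib c (f -[1+ B ]) (Σz B f) (f (+ suc B)))
  where distrib : ∀ c a b d → c * a + c * b + c * d ≡ c * (a + b + d)
        distrib = solve-∀

Σz-zero : ∀ B (f : ℤ → ℕ) → (∀ x → f x ≡ 0) → Σz B f ≡ 0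
Σz-zero zero f e = e _
Σz-zero (suc B) f e rewrite e -[1+ B ] | e (+ suc B) | Σz-zero B f e = refl

Σz-reflect : ∀ B (f : ℤ → ℕ) → Σz B (λ x → f (ℤ.- x)) ≡ Σz B f
Σz-reflect zero f = refl
Σz-reflect (suc B) f =
  trans (cong (λ k → f (+ suc B) + k + f -[1+ B ]) (Σz-reflect B f))
        (swap-ends (f (+ suc B)) (Σz B f) (f -[1+ B ]))
  where swap-ends : ∀ a b c → a + b + c ≡ c + b + a
        swap-ends = solve-∀

Σz-swap : ∀ B C (f : ℤ → ℤ → ℕ) →
          Σz B (λ x → Σz C (λ y → f x y)) ≡ Σz C (λ y → Σz B (λ x → f x y))
Σz-swap zero C f = refl
Σz-swap (suc B) C f = begin
    Σz C (f -[1+ B ]) + Σz B (λ x → Σz C (f x)) + Σz C (f (+ suc B))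
  ≡⟨ cong (λ k → Σz C (f -[1+ B ]) + k + Σz C (f (+ suc B))) (Σz-swap B C f) ⟩
    Σz C (f -[1+ B ]) + Σz C (λ y → Σz B (λ x → f x y)) + Σz C (f (+ suc B))
  ≡⟨ cong (_+ Σz C (f (+ suc B))) (sym (Σz-+ C (f -[1+ B ]) _)) ⟩
    Σz C (λ y → f -[1+ B ] y + Σz B (λ x → f x y)) + Σz C (f (+ suc B))
  ≡⟨ sym (Σz-+ C _ (f (+ suc B))) ⟩
    Σz C (λ y → Σz (suc B) (λ x → f x y)) ∎
  where open ≡-Reasoning

Supported : ℕ → (ℤ → ℕ) → Set
Supported B f = ∀ x → B < ∣ x ∣ → f x ≡ 0

supported : ∀ B (f : ℤ → ℕ) → (∀ x → f x ≢ 0 → ∣ x ∣ ≤ B) → Supported B f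
supported B f h x B<x with f x ℕ.≟ 0
... | yes fx≡0 = fx≡0
... | no fx≢0 = ⊥-elim (ℕP.<⇒≱ B<x (h x fx≢0))

supported-mono : ∀ {B C f} → Supported B f → B ≤ C → Supported C f
supported-mono s B≤C x C<x = s x (ℕP.≤-<-trans B≤C C<x)

Σz-stable : ∀ B C (f : ℤ → ℕ) → Supported B f → B ≤ C → Σz C f ≡ Σz B f
Σz-stable B C f s B≤C =
  trans (cong (λ m → Σz m f) (sym (ℕP.m+[n∸m]≡n B≤C))) (grow (C ∸ B))
  where
  grow : ∀ k → Σz (B + k) f ≡ Σz B f
  grow zero = cong (λ m → Σz m f) (ℕP.+-identityʳ B)
  grow (suc k) rewrite ℕP.+-suc B k
    | s -[1+ B + k ] (s≤s (ℕP.m≤m+n B k))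
    | s (+ suc (B + k)) (s≤s (ℕP.m≤m+n B k)) = trans (ℕP.+-identityʳ _) (grow k)

Σz-shift-one : ∀ B (f : ℤ → ℕ) →
               Σz B (λ x → f (x ℤ.+ + 1)) + f (ℤ.- (+ B)) ≡ Σz B f + f (+ suc B)
Σz-shift-one zero f = ℕP.+-comm (f (+ 1)) (f (+ 0))
Σz-shift-one (suc B) f = begin
    g -[1+ B ] + Σz B g + g (+ suc B) + f -[1+ B ]
  ≡⟨ cong₂ (λ u v → u + Σz B g + v + f -[1+ B ]) (cong f (left B)) (cong f (right B)) ⟩
    f (ℤ.- (+ B)) + Σz B g + f (+ suc (suc B)) + f -[1+ B ]
  ≡⟨ regroup₁ (f (ℤ.- (+ B))) (Σz B g) (f (+ suc (suc B))) (f -[1+ B ]) ⟩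
    (Σz B g + f (ℤ.- (+ B))) + f (+ suc (suc B)) + f -[1+ B ]
  ≡⟨ cong (λ k → k + f (+ suc (suc B)) + f -[1+ B ]) (Σz-shift-one B f) ⟩
    Σz B f + f (+ suc B) + f (+ suc (suc B)) + f -[1+ B ]
  ≡⟨ regroup₂ (Σz B f) (f (+ suc B)) (f (+ suc (suc B))) (f -[1+ B ]) ⟩
    f -[1+ B ] + Σz B f + f (+ suc B) + f (+ suc (suc B)) ∎
  where
  open ≡-Reasoning
  g : ℤ → ℕ
  g x = f (x ℤ.+ + 1)
  left : ∀ B → -[1+ B ] ℤ.+ + 1 ≡ ℤ.- (+ B)
  left B = lemma (+ B)
    where lemma : ∀ b → ℤ.- (ℤ.+ 1 ℤ.+ b) ℤ.+ ℤ.+ 1 ≡ ℤ.- b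
          lemma = ℤSolver.solve-∀
  right : ∀ B → + suc B ℤ.+ + 1 ≡ + suc (suc B)
  right B = cong +_ (ℕP.+-comm (suc B) 1)
  regroup₁ : ∀ a b c d → a + b + c + d ≡ (b + a) + c + d
  regroup₁ = solve-∀
  regroup₂ : ∀ a b c d → a + b + c + d ≡ d + a + b + c
  regroup₂ = solve-∀

∣x∣≤∣x+c∣+∣c∣ : ∀ x c → ∣ x ∣ ≤ ∣ x ℤ.+ c ∣ + ∣ c ∣
∣x∣≤∣x+c∣+∣c∣ x c =
  subst (λ t → ∣ t ∣ ≤ ∣ x ℤ.+ c ∣ + ∣ c ∣) (cancel x c)
    (subst (λ m → ∣ (x ℤ.+ c) ℤ.+ ℤ.- c ∣ ≤ ∣ x ℤ.+ c ∣ + m) (ℤP.∣-i∣≡∣i∣ c)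
      (ℤP.∣i+j∣≤∣i∣+∣j∣ (x ℤ.+ c) (ℤ.- c)))
  where cancel : ∀ x c → (x ℤ.+ c) ℤ.+ ℤ.- c ≡ x
        cancel = ℤSolver.solve-∀

Σz-shiftℕ : ∀ k B₀ B (f : ℤ → ℕ) → Supported B₀ f → B₀ + k ≤ B →
            Σz B (λ x → f (x ℤ.+ + k)) ≡ Σz B f
Σz-shiftℕ zero B₀ B f s le = Σz-cong B (λ x → cong f (ℤP.+-identityʳ x))
Σz-shiftℕ (suc k) B₀ B f s le = begin
    Σz B (λ x → f (x ℤ.+ + suc k))
  ≡⟨ Σz-cong B (λ x → cong f (reassoc x (+ k))) ⟩
    Σz B (λ x → g (x ℤ.+ + k))
  ≡⟨ Σz-shiftℕ k (suc B₀) B g sg (subst (_≤ B) (ℕP.+-suc B₀ k) le) ⟩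
    Σz B g
  ≡⟨ ℕP.+-cancelʳ-≡ _ _ _
       (trans (Σz-shift-one B f) (cong (_+_ (Σz B f)) (trans f-right (sym f-left)))) ⟩
    Σz B f ∎
  where
  open ≡-Reasoning
  g : ℤ → ℕ
  g x = f (x ℤ.+ + 1)
  reassoc : ∀ x y → x ℤ.+ (ℤ.+ 1 ℤ.+ y) ≡ (x ℤ.+ y) ℤ.+ ℤ.+ 1
  reassoc = ℤSolver.solve-∀
  B₀<B : B₀ < B
  B₀<B = ℕP.≤-trans (s≤s (ℕP.m≤m+n B₀ k)) (subst (_≤ B) (ℕP.+-suc B₀ k) le)
  sg : Supported (suc B₀) g
  sg x lt = s (x ℤ.+ + 1) (ℕP.+-cancelʳ-≤ 1 _ _
    (subst (_≤ ∣ x ℤ.+ + 1 ∣ + 1) (ℕP.+-comm 1 (suc B₀))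
      (ℕP.≤-trans lt (∣x∣≤∣x+c∣+∣c∣ x (+ 1)))))
  f-left : f (ℤ.- (+ B)) ≡ 0
  f-left = s _ (subst (B₀ <_) (sym (ℤP.∣-i∣≡∣i∣ (+ B))) B₀<B)
  f-right : f (+ suc B) ≡ 0
  f-right = s _ (ℕP.m<n⇒m<1+n B₀<B)

Σz-shift : ∀ c B₀ B (f : ℤ → ℕ) → Supported B₀ f → B₀ + ∣ c ∣ ≤ B →
           Σz B (λ x → f (x ℤ.+ c)) ≡ Σz B f
Σz-shift (+ k) B₀ B f s le = Σz-shiftℕ k B₀ B f s le
Σz-shift -[1+ k ] B₀ B f s le = begin
    Σz B (λ x → f (x ℤ.+ -[1+ k ]))
  ≡⟨ sym (Σz-reflect B _) ⟩
    Σz B (λ x → f (ℤ.- x ℤ.+ -[1+ k ]))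
  ≡⟨ Σz-cong B (λ x → cong f (negate x (+ k))) ⟩
    Σz B (λ x → f⁻ (x ℤ.+ + suc k))
  ≡⟨ Σz-shiftℕ (suc k) B₀ B f⁻ s⁻ le ⟩
    Σz B f⁻
  ≡⟨ Σz-reflect B f ⟩
    Σz B f ∎
  where
  open ≡-Reasoning
  f⁻ : ℤ → ℕ
  f⁻ y = f (ℤ.- y)
  negate : ∀ x y → ℤ.- x ℤ.+ ℤ.- (ℤ.+ 1 ℤ.+ y) ≡ ℤ.- (x ℤ.+ (ℤ.+ 1 ℤ.+ y))
  negate = ℤSolver.solve-∀
  s⁻ : Supported B₀ f⁻
  s⁻ x lt = s (ℤ.- x) (subst (B₀ <_) (sym (ℤP.∣-i∣≡∣i∣ x)) lt)

ev od : ℤ → ℤ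
ev u = + 2 ℤ.* u
od u = + 2 ℤ.* u ℤ.+ + 1

-- Splitting a box sum by parity.  The box |x| ≤ 2B + 1 contains exactly
-- one integer, -2B - 2, that is not of the form 2u or 2u + 1 with |u| ≤ B.
Σz-parity-exact : ∀ B (f : ℤ → ℕ) →
  Σz (suc (B + B)) f ≡ f -[1+ B + B ] + Σz B (f ∘ ev) + Σz B (f ∘ od)
Σz-parity-exact zero f = refl
Σz-parity-exact (suc B) f rewrite ℕP.+-suc B B = begin
    f -[1+ 2+2B ] + (f -[1+ 1+2B ] + Σz (suc (B + B)) f + f (+ 2+2B)) + f (+ 3+2B)
  ≡⟨ cong (λ k → f -[1+ 2+2B ] + (f -[1+ 1+2B ] + k + f (+ 2+2B)) + f (+ 3+2B))
          (Σz-parity-exact B f) ⟩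
    f -[1+ 2+2B ] + (f -[1+ 1+2B ] + (f -[1+ B + B ] + E + O) + f (+ 2+2B)) + f (+ 3+2B)
  ≡⟨ regroup (f -[1+ 2+2B ]) (f -[1+ 1+2B ]) (f -[1+ B + B ]) E O (f (+ 2+2B)) (f (+ 3+2B)) ⟩
    f -[1+ 2+2B ] + (f -[1+ 1+2B ] + E + f (+ 2+2B)) + (f -[1+ B + B ] + O + f (+ 3+2B))
  ≡⟨ cong₂ (λ u v → f -[1+ 2+2B ] + u + v)
       (cong₂ (λ u v → u + E + v) (cong f (sym (ev-neg B))) (cong f (sym (ev-pos B))))
       (cong₂ (λ u v → u + O + v) (cong f (sym (od-neg B))) (cong f (sym (od-pos B)))) ⟩
    f -[1+ 2+2B ] + Σz (suc B) (f ∘ ev) + Σz (suc B) (f ∘ od) ∎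
  where
  open ≡-Reasoning
  1+2B 2+2B 3+2B : ℕ
  1+2B = suc (B + B)
  2+2B = suc 1+2B
  3+2B = suc 2+2B
  E O : ℕ
  E = Σz B (f ∘ ev)
  O = Σz B (f ∘ od)
  regroup : ∀ a b c e o d g → a + (b + (c + e + o) + d) + g ≡ a + (b + e + d) + (c + o + g)
  regroup = solve-∀
  ev-neg : ∀ B → ev -[1+ B ] ≡ -[1+ suc (B + B) ]
  ev-neg B = lemma (+ B)
    where lemma : ∀ b → ℤ.+ 2 ℤ.* ℤ.- (ℤ.+ 1 ℤ.+ b) ≡ ℤ.- (ℤ.+ 1 ℤ.+ (ℤ.+ 1 ℤ.+ (b ℤ.+ b)))
          lemma = ℤSolver.solve-∀
  od-neg : ∀ B → od -[1+ B ] ≡ -[1+ B + B ]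
  od-neg B = lemma (+ B)
    where lemma : ∀ b → ℤ.+ 2 ℤ.* ℤ.- (ℤ.+ 1 ℤ.+ b) ℤ.+ ℤ.+ 1 ≡ ℤ.- (ℤ.+ 1 ℤ.+ (b ℤ.+ b))
          lemma = ℤSolver.solve-∀
  ev-pos : ∀ B → ev (+ suc B) ≡ + suc (suc (B + B))
  ev-pos B = lemma (+ B)
    where lemma : ∀ b → ℤ.+ 2 ℤ.* (ℤ.+ 1 ℤ.+ b) ≡ ℤ.+ 1 ℤ.+ (ℤ.+ 1 ℤ.+ (b ℤ.+ b))
          lemma = ℤSolver.solve-∀
  od-pos : ∀ B → od (+ suc B) ≡ + suc (suc (suc (B + B)))
  od-pos B = lemma (+ B)
    where lemma : ∀ b → ℤ.+ 2 ℤ.* (ℤ.+ 1 ℤ.+ b) ℤ.+ ℤ.+ 1 ≡ ℤ.+ 1 ℤ.+ (ℤ.+ 1 ℤ.+ (ℤ.+ 1 ℤ.+ (b ℤ.+ b)))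
          lemma = ℤSolver.solve-∀

Σz-parity : ∀ B (f : ℤ → ℕ) → Supported B f → Σz B f ≡ Σz B (f ∘ ev) + Σz B (f ∘ od)
Σz-parity B f s = begin
    Σz B f
  ≡⟨ sym (Σz-stable B (suc (B + B)) f s (ℕP.≤-trans (ℕP.m≤m+n B B) (ℕP.n≤1+n _))) ⟩
    Σz (suc (B + B)) f
  ≡⟨ Σz-parity-exact B f ⟩
    f -[1+ B + B ] + Σz B (f ∘ ev) + Σz B (f ∘ od)
  ≡⟨ cong (λ k → k + Σz B (f ∘ ev) + Σz B (f ∘ od)) (s _ (s≤s (ℕP.m≤m+n B B))) ⟩
    Σz B (f ∘ ev) + Σz B (f ∘ od) ∎
  where open ≡-Reasoning

ind-iff : {P Q : Set} (p : Dec P) (q : Dec Q) → (P → Q) → (Q → P) → ind p ≡ ind q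
ind-iff (yes _) (yes _) f g = refl
ind-iff (yes x) (no ¬y) f g = ⊥-elim (¬y (f x))
ind-iff (no ¬x) (yes y) f g = ⊥-elim (¬x (g y))
ind-iff (no _) (no _) f g = refl

ind-no : {P : Set} (p : Dec P) → ¬ P → ind p ≡ 0
ind-no (yes x) ¬x = ⊥-elim (¬x x)
ind-no (no _) ¬x = refl

ind-yes : {P : Set} (p : Dec P) → P → ind p ≡ 1
ind-yes (yes _) x = refl
ind-yes (no ¬x) x = ⊥-elim (¬x x)

ind≢0 : {P : Set} (p : Dec P) → ind p ≢ 0 → P
ind≢0 (yes x) _ = x
ind≢0 (no _) h = ⊥-elim (h refl)

data Dom : Set where
  ℤ¹ : Dom
  _⊗_ : Dom → Dom → Dom

El : Dom → Set
El ℤ¹ = ℤ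
El (T ⊗ U) = El T × El U

ΣD : (T : Dom) → ℕ → (El T → ℕ) → ℕ
ΣD ℤ¹ B f = Σz B f
ΣD (T ⊗ U) B f = ΣD T B (λ t → ΣD U B (λ u → f (t , u)))

ΣD-cong : ∀ T B {f g : El T → ℕ} → (∀ x → f x ≡ g x) → ΣD T B f ≡ ΣD T B g
ΣD-cong ℤ¹ B e = Σz-cong B e
ΣD-cong (T ⊗ U) B e = ΣD-cong T B (λ t → ΣD-cong U B (λ u → e (t , u)))

ΣD-+ : ∀ T B (f g : El T → ℕ) → ΣD T B (λ x → f x + g x) ≡ ΣD T B f + ΣD T B g
ΣD-+ ℤ¹ B f g = Σz-+ B f g
ΣD-+ (T ⊗ U) B f g = trans (ΣD-cong T B (λ t → ΣD-+ U B _ _)) (ΣD-+ T B _ _)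

ΣD-*ˡ : ∀ T B c (f : El T → ℕ) → ΣD T B (λ x → c * f x) ≡ c * ΣD T B f
ΣD-*ˡ ℤ¹ B c f = Σz-*ˡ B c f
ΣD-*ˡ (T ⊗ U) B c f = trans (ΣD-cong T B (λ t → ΣD-*ˡ U B c _)) (ΣD-*ˡ T B c _)

ΣD-zero : ∀ T B (f : El T → ℕ) → (∀ x → f x ≡ 0) → ΣD T B f ≡ 0
ΣD-zero ℤ¹ B f e = Σz-zero B f e
ΣD-zero (T ⊗ U) B f e =
  trans (ΣD-cong T B (λ t → ΣD-zero U B _ (λ u → e (t , u)))) (ΣD-zero T B (λ _ → 0) (λ _ → refl))

ΣD-product : ∀ T U B (f : El T → ℕ) (g : El U → ℕ) →
             ΣD T B f * ΣD U B g ≡ ΣD (T ⊗ U) B (λ p → f (proj₁ p) * g (proj₂ p))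
ΣD-product T U B f g =
  trans (sym (ΣD-*ʳ (ΣD U B g))) (ΣD-cong T B (λ t → sym (ΣD-*ˡ U B (f t) g)))
  where
  ΣD-*ʳ : ∀ c → ΣD T B (λ x → f x * c) ≡ ΣD T B f * c
  ΣD-*ʳ c = trans (ΣD-cong T B (λ x → ℕP.*-comm (f x) c))
                  (trans (ΣD-*ˡ T B c f) (ℕP.*-comm c _))

sumTo-cong≤ : ∀ {f g : ℕ → ℕ} n → (∀ i → i ≤ n → f i ≡ g i) → sumTo f n ≡ sumTo g n
sumTo-cong≤ zero e = e 0 z≤n
sumTo-cong≤ (suc n) e =
  cong₂ _+_ (sumTo-cong≤ n (λ i le → e i (ℕP.m≤n⇒m≤1+n le))) (e (suc n) ℕP.≤-refl)

sumTo-cong : ∀ {f g : ℕ → ℕ} n → (∀ i → f i ≡ g i) → sumTo f n ≡ sumTo g n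
sumTo-cong n e = sumTo-cong≤ n (λ i _ → e i)

sumTo-*ˡ : ∀ c (f : ℕ → ℕ) n → sumTo (λ i → c * f i) n ≡ c * sumTo f n
sumTo-*ˡ c f zero = refl
sumTo-*ˡ c f (suc n) =
  trans (cong (_+ c * f (suc n)) (sumTo-*ˡ c f n)) (sym (ℕP.*-distribˡ-+ c _ _))

sumTo-+ : ∀ (f g : ℕ → ℕ) n → sumTo (λ i → f i + g i) n ≡ sumTo f n + sumTo g n
sumTo-+ f g zero = refl
sumTo-+ f g (suc n) =
  trans (cong (_+ (f (suc n) + g (suc n))) (sumTo-+ f g n))
        (interchange (sumTo f n) (sumTo g n) (f (suc n)) (g (suc n)))
  where interchange : ∀ a b c d → a + b + (c + d) ≡ a + c + (b + d)
        interchange = solve-∀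

sumTo-ΣD : ∀ T B (h : ℕ → El T → ℕ) n →
           sumTo (λ i → ΣD T B (h i)) n ≡ ΣD T B (λ v → sumTo (λ i → h i v) n)
sumTo-ΣD T B h zero = refl
sumTo-ΣD T B h (suc n) =
  trans (cong (_+ ΣD T B (h (suc n))) (sumTo-ΣD T B h n)) (sym (ΣD-+ T B _ _))

sumTo-δ : ∀ a (h : ℕ → ℕ) m → a ≤ m → sumTo (λ i → ind (a ≟ i) * h i) m ≡ h a
sumTo-δ-out : ∀ a (h : ℕ → ℕ) m → m < a → sumTo (λ i → ind (a ≟ i) * h i) m ≡ 0
sumTo-δ a h zero z≤n = ℕP.+-identityʳ (h 0)
sumTo-δ a h (suc m) le with ℕP.m≤n⇒m<n∨m≡n le
... | inj₁ lt = trans (cong₂ _+_ (sumTo-δ a h m (ℕP.≤-pred lt))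
                        (cong (_* h (suc m)) (ind-no (a ≟ suc m) (λ e → ℕP.<-irrefl e lt))))
                      (ℕP.+-identityʳ _)
... | inj₂ refl = trans (cong₂ _+_ (sumTo-δ-out a h m ℕP.≤-refl)
                          (cong (_* h a) (ind-yes (a ≟ a) refl)))
                        (ℕP.+-identityʳ _)
sumTo-δ-out a h zero lt = cong (_* h 0) (ind-no (a ≟ 0) (λ e → ℕP.<-irrefl (sym e) lt))
sumTo-δ-out a h (suc m) lt =
  cong₂ _+_ (sumTo-δ-out a h m (ℕP.<-trans (ℕP.n<1+n m) lt))
            (cong (_* h (suc m)) (ind-no (a ≟ suc m) (λ e → ℕP.<-irrefl (sym e) lt)))

convolve-δ : ∀ p q m → sumTo (λ i → ind (p ≟ i) * ind (q ≟ m ∸ i)) m ≡ ind (p + q ≟ m)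
convolve-δ p q m with p ≤? m
... | yes p≤m = trans (sumTo-δ p (λ i → ind (q ≟ m ∸ i)) m p≤m)
      (ind-iff (q ≟ m ∸ p) (p + q ≟ m)
        (λ e → trans (cong (_+_ p) e) (ℕP.m+[n∸m]≡n p≤m))
        (λ e → sym (trans (cong (_∸ p) (sym e)) (ℕP.m+n∸m≡n p q))))
... | no p≰m = trans (sumTo-δ-out p _ m (ℕP.≰⇒> p≰m))
      (sym (ind-no (p + q ≟ m) (λ e → p≰m (subst (p ≤_) e (ℕP.m≤m+n p q)))))

-- The
-- multiplicity k records that 2ψ, rather than ψ, is a counting series.
record Counts (k : ℕ) (f : Series) (T : Dom) (F : El T → ℕ) : Set where
  constructor counting
  field coefficient : ∀ m B → m < B → k * f m ≡ ΣD T B (λ v → ind (F v ≟ m))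
open Counts public

counts-⊛ : ∀ {k l f g T U F G} → Counts k f T F → Counts l g U G →
           Counts (k * l) (f ⊛ g) (T ⊗ U) (λ p → F (proj₁ p) + G (proj₂ p))
counts-⊛ {k} {l} {f} {g} {T} {U} {F} {G} cf cg = counting λ m B m<B → begin
    k * l * sumTo (λ i → f i * g (m ∸ i)) m
  ≡⟨ sym (sumTo-*ˡ (k * l) _ m) ⟩
    sumTo (λ i → k * l * (f i * g (m ∸ i))) m
  ≡⟨ sumTo-cong≤ m (λ i i≤m → trans (rearrange k l (f i) (g (m ∸ i)))
       (cong₂ _*_ (coefficient cf i B (ℕP.≤-<-trans i≤m m<B)) (coefficient cg (m ∸ i) B (ℕP.≤-<-trans (ℕP.m∸n≤m m i) m<B)))) ⟩
    sumTo (λ i → ΣD T B (λ v → ind (F v ≟ i)) * ΣD U B (λ w → ind (G w ≟ m ∸ i))) m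
  ≡⟨ sumTo-cong m (λ i → ΣD-product T U B _ _) ⟩
    sumTo (λ i → ΣD (T ⊗ U) B (λ p → ind (F (proj₁ p) ≟ i) * ind (G (proj₂ p) ≟ m ∸ i))) m
  ≡⟨ sumTo-ΣD (T ⊗ U) B _ m ⟩
    ΣD (T ⊗ U) B (λ p → sumTo (λ i → ind (F (proj₁ p) ≟ i) * ind (G (proj₂ p) ≟ m ∸ i)) m)
  ≡⟨ ΣD-cong (T ⊗ U) B (λ p → convolve-δ (F (proj₁ p)) (G (proj₂ p)) m) ⟩
    ΣD (T ⊗ U) B (λ p → ind (F (proj₁ p) + G (proj₂ p) ≟ m)) ∎
  where
  open ≡-Reasoning
  rearrange : ∀ k l x y → k * l * (x * y) ≡ k * x * (l * y)
  rearrange = solve-∀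

qpow-≥ : ∀ c (f : Series) m → c ≤ m → qpow c f m ≡ f (m ∸ c)
qpow-≥ zero f m le = refl
qpow-≥ (suc c) f (suc m) (s≤s le) = qpow-≥ c f m le

qpow-< : ∀ c (f : Series) m → m < c → qpow c f m ≡ 0
qpow-< (suc c) f zero lt = refl
qpow-< (suc c) f (suc m) (s≤s lt) = qpow-< c f m lt

counts-qpow : ∀ {k f T F} c → Counts k f T F → Counts k (qpow c f) T (λ v → F v + c)
counts-qpow {k} {f} {T} {F} c cf = counting shifted
  where
  shifted : ∀ m B → m < B → k * qpow c f m ≡ ΣD T B (λ v → ind (F v + c ≟ m))
  shifted m B m<B with c ≤? m
  ... | yes c≤m =
    trans (cong (k *_) (qpow-≥ c f m c≤m))
      (trans (coefficient cf (m ∸ c) B (ℕP.≤-<-trans (ℕP.m∸n≤m m c) m<B))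
        (ΣD-cong T B (λ v → ind-iff (F v ≟ m ∸ c) (F v + c ≟ m)
          (λ e → trans (cong (_+ c) e) (ℕP.m∸n+n≡m c≤m))
          (λ e → trans (sym (ℕP.m+n∸n≡m (F v) c)) (cong (_∸ c) e)))))
  ... | no c≰m =
    trans (trans (cong (k *_) (qpow-< c f m (ℕP.≰⇒> c≰m))) (ℕP.*-zeroʳ k))
      (sym (ΣD-zero T B _ (λ v → ind-no (F v + c ≟ m)
        (λ e → c≰m (subst (c ≤_) e (ℕP.m≤n+m c (F v)))))))

-- Triangular numbers T j = j(j + 1)/2, and tri x = T j for x = j or x = -1 - j:
-- every triangular number has exactly two preimages under tri.
T : ℕ → ℕ
T j = (j * suc j) / 2

pronic-even : ∀ j → Σ ℕ (λ h → j * suc j ≡ h * 2)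
pronic-even zero = 0 , refl
pronic-even (suc j) with pronic-even j
... | h , e = h + suc j ,
      trans (step j) (trans (cong (_+ suc j * 2) e) (sym (ℕP.*-distribʳ-+ 2 h (suc j))))
  where step : ∀ j → suc j * suc (suc j) ≡ j * suc j + suc j * 2
        step = solve-∀

T*2 : ∀ j → T j * 2 ≡ j * suc j
T*2 j with pronic-even j
... | h , e = trans (cong (_* 2) (trans (cong (_/ 2) e) (m*n/n≡m h 2))) (sym e)

tri : ℤ → ℕ
tri (+ j) = T j
tri -[1+ j ] = T j

j≤T : ∀ j → j ≤ T j
j≤T zero = z≤n
j≤T (suc j) = ℕP.*-cancelʳ-≤ (suc j) (T (suc j)) 2
  (subst (suc j * 2 ≤_) (sym (T*2 (suc j))) (ℕP.*-monoʳ-≤ (suc j) (s≤s (s≤s z≤n))))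

-- n ≤ k n² for k ≥ 1: weights dominate the coordinates, which bounds the boxes.
n≤k*n : ∀ k n → 1 ≤ k → n ≤ k * n
n≤k*n (suc k) n _ = ℕP.m≤n*m n (suc k)

n≤k*[n*n] : ∀ k n → 1 ≤ k → n ≤ k * (n * n)
n≤k*[n*n] k zero _ = z≤n
n≤k*[n*n] k (suc n) k≥1 = ℕP.≤-trans (ℕP.m≤m*n (suc n) (suc n)) (n≤k*n k _ k≥1)

square-abs : ∀ x → x ℤ.* x ≡ + (∣ x ∣ * ∣ x ∣)
square-abs (+ zero) = refl
square-abs (+ suc n) = refl
square-abs -[1+ n ] = refl

counts-phi : ∀ k → 1 ≤ k → Counts 1 (phi k) ℤ¹ (λ x → k * (∣ x ∣ * ∣ x ∣))
counts-phi k k≥1 = counting count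
  where
  count : ∀ m B → m < B → 1 * phi k m ≡ Σz B (λ x → ind (k * (∣ x ∣ * ∣ x ∣) ≟ m))
  count m B m<B = begin
      1 * sumZ m (λ x → ind (+ k ℤ.* x ℤ.* x ℤ.≟ + m))
    ≡⟨ ℕP.*-identityˡ _ ⟩
      sumZ m (λ x → ind (+ k ℤ.* x ℤ.* x ℤ.≟ + m))
    ≡⟨ sumZ≡Σz m _ ⟩
      Σz m (λ x → ind (+ k ℤ.* x ℤ.* x ℤ.≟ + m))
    ≡⟨ Σz-cong m (λ x → ind-iff (+ k ℤ.* x ℤ.* x ℤ.≟ + m) (W x ≟ m)
         (λ e → ℤP.+-injective (trans (sym (kx² x)) e)) (λ e → trans (kx² x) (cong +_ e))) ⟩
      Σz m g
    ≡⟨ sym (Σz-stable m B g g-supported (ℕP.<⇒≤ m<B)) ⟩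
      Σz B g ∎
    where
    open ≡-Reasoning
    W : ℤ → ℕ
    W x = k * (∣ x ∣ * ∣ x ∣)
    g : ℤ → ℕ
    g x = ind (W x ≟ m)
    kx² : ∀ x → + k ℤ.* x ℤ.* x ≡ + W x
    kx² x = trans (ℤP.*-assoc (+ k) x x)
      (trans (cong (+ k ℤ.*_) (square-abs x)) (sym (ℤP.pos-* k _)))
    g-supported : Supported m g
    g-supported x m<x = ind-no (W x ≟ m)
      (λ e → ℕP.<⇒≱ m<x (subst (∣ x ∣ ≤_) e (n≤k*[n*n] k ∣ x ∣ k≥1)))

-- Σ_{|x| ≤ B} H(tri x) counts every T j (j ≤ B) twice, except T B only once.
Σz-tri : ∀ (H : ℕ → ℕ) B → Σz B (H ∘ tri) + H (T B) ≡ 2 * sumF (H ∘ T) (suc B)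
Σz-tri H zero = double (H 0)
  where double : ∀ h → h + h ≡ 2 * (h + 0)
        double = solve-∀
Σz-tri H (suc B) = begin
    H (T B) + Σz B (H ∘ tri) + H (T (suc B)) + H (T (suc B))
  ≡⟨ regroup (H (T B)) (Σz B (H ∘ tri)) (H (T (suc B))) ⟩
    (Σz B (H ∘ tri) + H (T B)) + 2 * H (T (suc B))
  ≡⟨ cong (_+ 2 * H (T (suc B))) (Σz-tri H B) ⟩
    2 * sumF (H ∘ T) (suc B) + 2 * H (T (suc B))
  ≡⟨ sym (ℕP.*-distribˡ-+ 2 (sumF (H ∘ T) (suc B)) (H (T (suc B)))) ⟩
    2 * (sumF (H ∘ T) (suc B) + H (T (suc B)))
  ≡⟨ cong (2 *_) (sym (sumF-snoc (H ∘ T) (suc B))) ⟩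
    2 * sumF (H ∘ T) (suc (suc B)) ∎
  where
  open ≡-Reasoning
  regroup : ∀ a b c → a + b + c + c ≡ (b + a) + 2 * c
  regroup = solve-∀

counts-psi : ∀ k → 1 ≤ k → Counts 2 (psi k) ℤ¹ (λ x → k * tri x)
counts-psi k k≥1 = counting count
  where
  count : ∀ m B → m < B → 2 * psi k m ≡ Σz B (λ x → ind (k * tri x ≟ m))
  count m B m<B = begin
      2 * sum (map H′ (applyUpTo id (suc m)))
    ≡⟨ cong (2 *_) (trans (cong sum (map-applyUpTo H′ id (suc m))) (sum-applyUpTo H′ (suc m))) ⟩
      2 * sumF H′ (suc m)
    ≡⟨ cong (2 *_) (sym (trans (cong (sumF H′) (sym (ℕP.m+[n∸m]≡n m<1+B)))
                           (sumF-stable H′ (suc m) (suc B ∸ suc m) H′-vanishes))) ⟩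
      2 * sumF H′ (suc B)
    ≡⟨ sym (Σz-tri H B) ⟩
      Σz B (H ∘ tri) + H (T B)
    ≡⟨ cong (_+_ (Σz B (H ∘ tri))) (H′-vanishes B m<B) ⟩
      Σz B (H ∘ tri) + 0
    ≡⟨ ℕP.+-identityʳ _ ⟩
      Σz B (λ x → ind (k * tri x ≟ m)) ∎
    where
    open ≡-Reasoning
    H : ℕ → ℕ
    H t = ind (k * t ≟ m)
    H′ : ℕ → ℕ
    H′ = H ∘ T
    m<1+B : suc m ≤ suc B
    m<1+B = ℕP.m≤n⇒m≤1+n m<B
    H′-vanishes : ∀ j → m < j → H′ j ≡ 0
    H′-vanishes j m<j = ind-no (k * T j ≟ m)
      (λ e → ℕP.<⇒≱ m<j (subst (j ≤_) e (ℕP.≤-trans (j≤T j) (n≤k*n k _ k≥1))))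

⊛-distribʳ-⊕ : ∀ (f g h : Series) n → ((f ⊕ g) ⊛ h) n ≡ (f ⊛ h) n + (g ⊛ h) n
⊛-distribʳ-⊕ f g h n =
  trans (sumTo-cong n (λ i → ℕP.*-distribʳ-+ (h (n ∸ i)) (f i) (g i))) (sumTo-+ _ _ n)

qpow-⊕ : ∀ c (f g : Series) n → qpow c (f ⊕ g) n ≡ qpow c f n + qpow c g n
qpow-⊕ zero f g n = refl
qpow-⊕ (suc c) f g zero = refl
qpow-⊕ (suc c) f g (suc n) = qpow-⊕ c f g n

qpow-cong : ∀ c {f g : Series} → (∀ i → f i ≡ g i) → ∀ n → qpow c f n ≡ qpow c g n
qpow-cong zero e n = e n
qpow-cong (suc c) e zero = refl
qpow-cong (suc c) e (suc n) = qpow-cong c e n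

split-sum : ∀ c (f g h : Series) n → qpow c ((f ⊕ g) ⊛ h) n ≡ qpow c (f ⊛ h) n + qpow c (g ⊛ h) n
split-sum c f g h n = trans (qpow-cong c (⊛-distribʳ-⊕ f g h) n) (qpow-⊕ c (f ⊛ h) (g ⊛ h) n)

-- Expanding maps: |u| ≤ |φ u|.  Substituting such a map into a summand
-- preserves its support.
Expanding : (ℤ → ℤ) → Set
Expanding φ = ∀ u → ∣ u ∣ ≤ ∣ φ u ∣

od-pos : ∀ j → od (+ j) ≡ + suc (j + j)
od-pos j = lemma (+ j)
  where lemma : ∀ b → ℤ.+ 2 ℤ.* b ℤ.+ ℤ.+ 1 ≡ ℤ.+ 1 ℤ.+ (b ℤ.+ b)
        lemma = ℤSolver.solve-∀

od-neg : ∀ j → od -[1+ j ] ≡ -[1+ j + j ]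
od-neg j = lemma (+ j)
  where lemma : ∀ b → ℤ.+ 2 ℤ.* ℤ.- (ℤ.+ 1 ℤ.+ b) ℤ.+ ℤ.+ 1 ≡ ℤ.- (ℤ.+ 1 ℤ.+ (b ℤ.+ b))
        lemma = ℤSolver.solve-∀

ev-expanding : Expanding ev
ev-expanding u = subst (∣ u ∣ ≤_) (sym (ℤP.abs-* (+ 2) u)) (ℕP.m≤m+n ∣ u ∣ _)

od-expanding : Expanding od
od-expanding (+ j) rewrite od-pos j = ℕP.≤-trans (ℕP.m≤m+n j j) (ℕP.n≤1+n _)
od-expanding -[1+ j ] rewrite od-neg j = s≤s (ℕP.m≤m+n j j)

∘-expanding : ∀ {φ ψ} → Expanding φ → Expanding ψ → Expanding (φ ∘ ψ)
∘-expanding eφ eψ u = ℕP.≤-trans (eψ u) (eφ _)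

8T+1 : ∀ j → 8 * T j + 1 ≡ suc (j + j) * suc (j + j)
8T+1 j = trans (cong (_+ 1) (trans (regroup (T j)) (cong (4 *_) (T*2 j)))) (expand j)
  where regroup : ∀ t → 8 * t ≡ 4 * (t * 2)
        regroup = solve-∀
        expand : ∀ j → 4 * (j * suc j) + 1 ≡ suc (j + j) * suc (j + j)
        expand = solve-∀

square-od : ∀ u → od u ℤ.* od u ≡ + (8 * tri u + 1)
square-od (+ j) rewrite od-pos j = cong +_ (sym (8T+1 j))
square-od -[1+ j ] rewrite od-neg j = cong +_ (sym (8T+1 j))

norm : ℤ → ℤ → ℤ
norm x y = x ℤ.* x ℤ.+ + 3 ℤ.* (y ℤ.* y)

-- Write x = 2u + 1, y = 2v + 1.  For fixed u, split v by the parity of v - u: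
-- the two halves correspond under y ↦ -y, so the row sum is twice the sum over
-- v = 2s + u.  Then x² + 3y² = (2(2u + 3s + 1))² + 3(2s)², and after translating
-- u by 3v resp. 3v + 2, s = 2v gives x ≡ 2, y ≡ 0 (mod 4) and s = 2v + 1 gives
-- x ≡ 0, y ≡ 2 (mod 4).
module OddPairs (g : ℤ → ℕ) (R B : ℕ)
  (bounded : ∀ x y → g (norm x y) ≢ 0 → ∣ x ∣ ≤ R × ∣ y ∣ ≤ R)
  (large : 4 * R + 4 ≤ B) where

  open ≡-Reasoning

  G : ℤ → ℤ → ℕ
  G x y = g (norm x y)

  vanish₁ : ∀ x y → R < ∣ x ∣ → G x y ≡ 0
  vanish₁ x y R<x = decidable-stable (G x y ≟ 0) (λ ne → ℕP.<⇒≱ R<x (proj₁ (bounded x y ne)))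
  vanish₂ : ∀ x y → R < ∣ y ∣ → G x y ≡ 0
  vanish₂ x y R<y = decidable-stable (G x y ≟ 0) (λ ne → ℕP.<⇒≱ R<y (proj₂ (bounded x y ne)))

  small₁ : ∀ φ → Expanding φ → ∀ u y → G (φ u) y ≢ 0 → ∣ u ∣ ≤ R
  small₁ φ eφ u y ne = ℕP.≤-trans (eφ u) (proj₁ (bounded (φ u) y ne))
  small₂ : ∀ φ → Expanding φ → ∀ x v → G x (φ v) ≢ 0 → ∣ v ∣ ≤ R
  small₂ φ eφ x v ne = ℕP.≤-trans (eφ v) (proj₂ (bounded x (φ v) ne))

  fits : ∀ a c → a + c ≡ 4 * R + 4 → a ≤ B
  fits a c eq = ℕP.≤-trans (ℕP.m≤m+n a c) (subst (_≤ B) (sym eq) large)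

  2R≤B : R + R ≤ B
  2R≤B = fits (R + R) (R + R + 4) (excess R)
    where excess : ∀ R → R + R + (R + R + 4) ≡ 4 * R + 4
          excess = solve-∀

  half-row : ℤ → ℕ
  half-row u = Σz B (λ s → G (od u) (od (ev s ℤ.+ u)))

  row-halves : ∀ u → Σz B (λ v → G (od u) (od v)) ≡ half-row u + half-row u
  row-halves u with ∣ u ∣ ≤? R
  ... | no u≰R = trans (Σz-zero B _ (λ v → vanish₁ (od u) (od v) R<od))
                       (sym (cong₂ _+_ half-zero half-zero))
    where
    R<od : R < ∣ od u ∣
    R<od = ℕP.<-≤-trans (ℕP.≰⇒> u≰R) (od-expanding u)
    half-zero : half-row u ≡ 0
    half-zero = Σz-zero B _ (λ s → vanish₁ (od u) (od (ev s ℤ.+ u)) R<od)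
  ... | yes u≤R = begin
      Σz B f
    ≡⟨ sym (Σz-shift u R B f f-supported (ℕP.≤-trans (ℕP.+-monoʳ-≤ R u≤R) 2R≤B)) ⟩
      Σz B h
    ≡⟨ Σz-parity B h h-supported ⟩
      half-row u + Σz B (λ s → h (od s))
    ≡⟨ cong (_+_ (half-row u))
         (trans (Σz-cong B (λ s → cong g (reflect-norm u s)))
           (trans (Σz-shift (u ℤ.+ + 1) (R + R) B f′ f′-supported u+1-ok) (Σz-reflect B F))) ⟩
      half-row u + half-row u ∎
    where
    f h F f′ : ℤ → ℕ
    f v = G (od u) (od v)
    h t = f (t ℤ.+ u)
    F s = G (od u) (od (ev s ℤ.+ u))
    f′ y = F (ℤ.- y)
    -- (The local abbreviations restate norm, ev and od for the ring solver.)
    reflect-norm :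
      let N = λ x y → x ℤ.* x ℤ.+ + 3 ℤ.* (y ℤ.* y)
          ev = λ x → + 2 ℤ.* x
          od = λ x → + 2 ℤ.* x ℤ.+ + 1 in
      ∀ u s → N (od u) (od (od s ℤ.+ u)) ≡ N (od u) (od (ev (ℤ.- (s ℤ.+ (u ℤ.+ + 1))) ℤ.+ u))
    reflect-norm = ℤSolver.solve-∀
    u+1-ok : R + R + ∣ u ℤ.+ + 1 ∣ ≤ B
    u+1-ok = ℕP.≤-trans
      (ℕP.+-monoʳ-≤ (R + R) (ℕP.≤-trans (ℤP.∣i+j∣≤∣i∣+∣j∣ u (+ 1)) (ℕP.+-monoˡ-≤ 1 u≤R)))
      (fits (R + R + (R + 1)) (R + 3) (excess R))
      where excess : ∀ R → R + R + (R + 1) + (R + 3) ≡ 4 * R + 4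
            excess = solve-∀
    f-supported : Supported R f
    f-supported = supported R f (λ v → small₂ od od-expanding (od u) v)
    h-supported : Supported B h
    h-supported = supported B h (λ t ne → ℕP.≤-trans (∣x∣≤∣x+c∣+∣c∣ t u)
      (ℕP.≤-trans (ℕP.+-mono-≤ (small₂ od od-expanding (od u) (t ℤ.+ u) ne) u≤R) 2R≤B))
    f′-supported : Supported (R + R) f′
    f′-supported = supported (R + R) f′ (λ y ne →
      ℕP.≤-trans (subst (_≤ ∣ ev (ℤ.- y) ∣) (ℤP.∣-i∣≡∣i∣ y) (ev-expanding (ℤ.- y)))
        (ℕP.≤-trans (∣x∣≤∣x+c∣+∣c∣ (+ 2 ℤ.* ℤ.- y) u)
          (ℕP.+-mono-≤ (small₂ od od-expanding (od u) (ev (ℤ.- y) ℤ.+ u) ne) u≤R)))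

  column : ℤ → ℕ
  column s = Σz B (λ u → G (ev (ev u ℤ.+ + 3 ℤ.* s ℤ.+ + 1)) (ev s))

  rows≡columns : Σz B half-row ≡ Σz B column
  rows≡columns = trans (Σz-cong B (λ u → Σz-cong B (λ s → cong g (rotate-norm u s))))
                       (Σz-swap B B _)
    where
    rotate-norm :
      let N = λ x y → x ℤ.* x ℤ.+ + 3 ℤ.* (y ℤ.* y)
          ev = λ x → + 2 ℤ.* x
          od = λ x → + 2 ℤ.* x ℤ.+ + 1 in
      ∀ u s → N (od u) (od (ev s ℤ.+ u)) ≡ N (ev (ev u ℤ.+ + 3 ℤ.* s ℤ.+ + 1)) (ev s)
    rotate-norm = ℤSolver.solve-∀

  column-supported : Supported B column
  column-supported = supported-mono {R}
    (λ s R<s → Σz-zero B _ (λ u → vanish₂ (ev (ev u ℤ.+ + 3 ℤ.* s ℤ.+ + 1)) (ev s) (ℕP.<-≤-trans R<s (ev-expanding s))))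
    (fits R (3 * R + 4) (excess R))
    where excess : ∀ R → R + (3 * R + 4) ≡ 4 * R + 4
          excess = solve-∀

  even-column : ∀ v → column (ev v) ≡ Σz B (λ u → G (ev (od u)) (ev (ev v)))
  even-column v with ∣ v ∣ ≤? R
  ... | no v≰R = trans (Σz-zero B _ (λ u → vanish₂ (ev (ev u ℤ.+ + 3 ℤ.* ev v ℤ.+ + 1)) (ev (ev v)) R<y))
                       (sym (Σz-zero B _ (λ u → vanish₂ (ev (od u)) (ev (ev v)) R<y)))
    where R<y : R < ∣ ev (ev v) ∣
          R<y = ℕP.<-≤-trans (ℕP.≰⇒> v≰R) (∘-expanding {ev} {ev} ev-expanding ev-expanding v)
  ... | yes v≤R = trans (Σz-cong B (λ u → cong g (shift-norm u v)))
                        (Σz-shift (+ 3 ℤ.* v) R B f f-supported shift-ok)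
    where
    f : ℤ → ℕ
    f u = G (ev (od u)) (ev (ev v))
    shift-norm :
      let N = λ x y → x ℤ.* x ℤ.+ + 3 ℤ.* (y ℤ.* y)
          ev = λ x → + 2 ℤ.* x
          od = λ x → + 2 ℤ.* x ℤ.+ + 1 in
      ∀ u v → N (ev (ev u ℤ.+ + 3 ℤ.* ev v ℤ.+ + 1)) (ev (ev v)) ≡ N (ev (od (u ℤ.+ + 3 ℤ.* v))) (ev (ev v))
    shift-norm = ℤSolver.solve-∀
    f-supported : Supported R f
    f-supported = supported R f (λ u → small₁ (ev ∘ od) (∘-expanding {ev} {od} ev-expanding od-expanding) u (ev (ev v)))
    shift-ok : R + ∣ + 3 ℤ.* v ∣ ≤ B
    shift-ok = subst (λ t → R + t ≤ B) (sym (ℤP.abs-* (+ 3) v))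
      (ℕP.≤-trans (ℕP.+-monoʳ-≤ R (ℕP.*-monoʳ-≤ 3 v≤R)) (fits (R + 3 * R) 4 (excess R)))
      where excess : ∀ R → R + 3 * R + 4 ≡ 4 * R + 4
            excess = solve-∀

  odd-column : ∀ v → column (od v) ≡ Σz B (λ u → G (ev (ev u)) (ev (od v)))
  odd-column v with ∣ v ∣ ≤? R
  ... | no v≰R = trans (Σz-zero B _ (λ u → vanish₂ (ev (ev u ℤ.+ + 3 ℤ.* od v ℤ.+ + 1)) (ev (od v)) R<y))
                       (sym (Σz-zero B _ (λ u → vanish₂ (ev (ev u)) (ev (od v)) R<y)))
    where R<y : R < ∣ ev (od v) ∣
          R<y = ℕP.<-≤-trans (ℕP.≰⇒> v≰R) (∘-expanding {ev} {od} ev-expanding od-expanding v)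
  ... | yes v≤R = trans (Σz-cong B (λ u → cong g (shift-norm u v)))
                        (Σz-shift (+ 3 ℤ.* v ℤ.+ + 2) R B f f-supported shift-ok)
    where
    f : ℤ → ℕ
    f u = G (ev (ev u)) (ev (od v))
    shift-norm :
      let N = λ x y → x ℤ.* x ℤ.+ + 3 ℤ.* (y ℤ.* y)
          ev = λ x → + 2 ℤ.* x
          od = λ x → + 2 ℤ.* x ℤ.+ + 1 in
      ∀ u v → N (ev (ev u ℤ.+ + 3 ℤ.* od v ℤ.+ + 1)) (ev (od v)) ≡ N (ev (ev (u ℤ.+ (+ 3 ℤ.* v ℤ.+ + 2)))) (ev (od v))
    shift-norm = ℤSolver.solve-∀
    f-supported : Supported R f
    f-supported = supported R f (λ u → small₁ (ev ∘ ev) (∘-expanding {ev} {ev} ev-expanding ev-expanding) u (ev (od v)))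
    shift-ok : R + ∣ + 3 ℤ.* v ℤ.+ + 2 ∣ ≤ B
    shift-ok = ℕP.≤-trans
      (ℕP.+-monoʳ-≤ R (ℕP.≤-trans (ℤP.∣i+j∣≤∣i∣+∣j∣ (+ 3 ℤ.* v) (+ 2))
        (ℕP.+-monoˡ-≤ 2 (subst (_≤ 3 * R) (sym (ℤP.abs-* (+ 3) v)) (ℕP.*-monoʳ-≤ 3 v≤R)))))
      (fits (R + (3 * R + 2)) 2 (excess R))
      where excess : ∀ R → R + (3 * R + 2) + 2 ≡ 4 * R + 4
            excess = solve-∀

  odd-pairs : Σz B (λ u → Σz B (λ v → G (od u) (od v))) ≡
              2 * (Σz B (λ u → Σz B (λ v → G (ev (od u)) (ev (ev v))))
                 + Σz B (λ u → Σz B (λ v → G (ev (ev u)) (ev (od v)))))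
  odd-pairs = begin
      Σz B (λ u → Σz B (λ v → G (od u) (od v)))
    ≡⟨ trans (Σz-cong B (λ u → trans (row-halves u) (twice (half-row u)))) (Σz-*ˡ B 2 half-row) ⟩
      2 * Σz B half-row
    ≡⟨ cong (2 *_) (trans rows≡columns (Σz-parity B column column-supported)) ⟩
      2 * (Σz B (column ∘ ev) + Σz B (column ∘ od))
    ≡⟨ cong (2 *_) (cong₂ _+_ (trans (Σz-cong B even-column) (Σz-swap B B _))
                              (trans (Σz-cong B odd-column) (Σz-swap B B _))) ⟩
      2 * (Σz B (λ u → Σz B (λ v → G (ev (od u)) (ev (ev v))))
         + Σz B (λ u → Σz B (λ v → G (ev (ev u)) (ev (od v))))) ∎
    where twice : ∀ n → n + n ≡ 2 * n
          twice = solve-∀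

S3 : ℕ → (ℤ → ℤ → ℤ → ℕ) → ℕ
S3 B F = Σz B (λ x → Σz B (λ y → Σz B (λ z → F x y z)))

Supported3 : ℕ → (ℤ → ℤ → ℤ → ℕ) → Set
Supported3 B F = ∀ x y z → F x y z ≢ 0 → (∣ x ∣ ≤ B) × (∣ y ∣ ≤ B) × (∣ z ∣ ≤ B)

S3-cong : ∀ B {F G : ℤ → ℤ → ℤ → ℕ} → (∀ x y z → F x y z ≡ G x y z) → S3 B F ≡ S3 B G
S3-cong B e = Σz-cong B (λ x → Σz-cong B (λ y → Σz-cong B (λ z → e x y z)))

S3-zero : ∀ B (F : ℤ → ℤ → ℤ → ℕ) → (∀ x y z → F x y z ≡ 0) → S3 B F ≡ 0
S3-zero B F e = trans (S3-cong B e) (Σz-zero B _ (λ x → Σz-zero B _ (λ y → Σz-zero B _ (λ z → refl))))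

slice₁ : ∀ {B} C F → Supported3 B F → Supported B (λ x → Σz C (λ y → Σz C (λ z → F x y z)))
slice₁ C F s x B<x = Σz-zero C _ (λ y → Σz-zero C _ (λ z →
  decidable-stable (F x y z ≟ 0) (λ ne → ℕP.<⇒≱ B<x (proj₁ (s x y z ne)))))

slice₂ : ∀ {B} C F → Supported3 B F → ∀ x → Supported B (λ y → Σz C (λ z → F x y z))
slice₂ C F s x y B<y = Σz-zero C _ (λ z →
  decidable-stable (F x y z ≟ 0) (λ ne → ℕP.<⇒≱ B<y (proj₁ (proj₂ (s x y z ne)))))

slice₃ : ∀ {B} F → Supported3 B F → ∀ x y → Supported B (λ z → F x y z)
slice₃ F s x y z B<z = decidable-stable (F x y z ≟ 0) (λ ne → ℕP.<⇒≱ B<z (proj₂ (proj₂ (s x y z ne))))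

S3-stable : ∀ B C F → Supported3 B F → B ≤ C → S3 C F ≡ S3 B F
S3-stable B C F s B≤C = begin
    S3 C F
  ≡⟨ Σz-cong C (λ x → Σz-cong C (λ y → Σz-stable B C _ (slice₃ F s x y) B≤C)) ⟩
    Σz C (λ x → Σz C (λ y → Σz B (λ z → F x y z)))
  ≡⟨ Σz-cong C (λ x → Σz-stable B C _ (slice₂ B F s x) B≤C) ⟩
    Σz C (λ x → Σz B (λ y → Σz B (λ z → F x y z)))
  ≡⟨ Σz-stable B C _ (slice₁ B F s) B≤C ⟩
    S3 B F ∎
  where open ≡-Reasoning

S3-parity₁ : ∀ B F → Supported3 B F →
  S3 B F ≡ S3 B (λ x y z → F (ev x) y z) + S3 B (λ x y z → F (od x) y z)
S3-parity₁ B F s = Σz-parity B _ (slice₁ B F s)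

S3-parity₂ : ∀ B F → Supported3 B F →
  S3 B F ≡ S3 B (λ x y z → F x (ev y) z) + S3 B (λ x y z → F x (od y) z)
S3-parity₂ B F s = trans (Σz-cong B (λ x → Σz-parity B _ (slice₂ B F s x))) (Σz-+ B _ _)

S3-parity₃ : ∀ B F → Supported3 B F →
  S3 B F ≡ S3 B (λ x y z → F x y (ev z)) + S3 B (λ x y z → F x y (od z))
S3-parity₃ B F s =
  trans (Σz-cong B (λ x → trans (Σz-cong B (λ y → Σz-parity B _ (slice₃ F s x y))) (Σz-+ B _ _)))
        (Σz-+ B _ _)

Supported3-∘ : ∀ {B F} φ ψ χ → Expanding φ → Expanding ψ → Expanding χ → Supported3 B F →
               Supported3 B (λ u v w → F (φ u) (ψ v) (χ w))
Supported3-∘ φ ψ χ eφ eψ eχ s u v w ne with s (φ u) (ψ v) (χ w) ne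
... | bu , bv , bw = ℕP.≤-trans (eφ u) bu , ℕP.≤-trans (eψ v) bv , ℕP.≤-trans (eχ w) bw

Supported3-mono : ∀ {B C F} → Supported3 B F → B ≤ C → Supported3 C F
Supported3-mono s B≤C x y z ne with s x y z ne
... | bx , by , bz = ℕP.≤-trans bx B≤C , ℕP.≤-trans by B≤C , ℕP.≤-trans bz B≤C

S3-z-outer : ∀ B F → S3 B F ≡ Σz B (λ z → Σz B (λ x → Σz B (λ y → F x y z)))
S3-z-outer B F = trans (Σz-cong B (λ x → Σz-swap B B (λ y z → F x y z)))
                       (Σz-swap B B (λ x z → Σz B (λ y → F x y z)))

S3-swap₁₂ : ∀ B F → S3 B F ≡ S3 B (λ y x z → F x y z)
S3-swap₁₂ B F = Σz-swap B B (λ x y → Σz B (λ z → F x y z))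

data Class : Set where
  all even mult4 odd twiceOdd : Class

embed : Class → ℤ → ℤ
embed all u = u
embed even u = ev u
embed mult4 u = ev (ev u)
embed odd u = od u
embed twiceOdd u = ev (od u)

embed-expanding : ∀ k → Expanding (embed k)
embed-expanding all u = ℕP.≤-refl
embed-expanding even = ev-expanding
embed-expanding mult4 = ∘-expanding {ev} {ev} ev-expanding ev-expanding
embed-expanding odd = od-expanding
embed-expanding twiceOdd = ∘-expanding {ev} {od} ev-expanding od-expanding

-- (embed k u)² = scale k · size k u + offset k, where size is |u|² on the
-- classes u, 2u, 4u and the triangular number tri u on 2u + 1, 2(2u + 1).
size : Class → ℤ → ℕ
size odd u = tri u
size twiceOdd u = tri u
size _ u = ∣ u ∣ * ∣ u ∣

scale offset : Class → ℕ
scale all = 1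
scale even = 4
scale mult4 = 16
scale odd = 8
scale twiceOdd = 32
offset odd = 1
offset twiceOdd = 4
offset _ = 0

multiple : ∀ m w {x} → x ≡ + m ℤ.* + w → x ≡ + (m * w + 0)
multiple m w e = trans e (trans (sym (ℤP.pos-* m w)) (cong +_ (sym (ℕP.+-identityʳ (m * w)))))

square-embed : ∀ k u → embed k u ℤ.* embed k u ≡ + (scale k * size k u + offset k)
square-embed all u = trans (square-abs u) (cong +_ (unit (∣ u ∣ * ∣ u ∣)))
  where unit : ∀ n → n ≡ 1 * n + 0
        unit = solve-∀
square-embed even u = multiple 4 (∣ u ∣ * ∣ u ∣) (trans (expand u) (cong (+ 4 ℤ.*_) (square-abs u)))
  where expand : let ev = λ x → + 2 ℤ.* x in ∀ u → ev u ℤ.* ev u ≡ + 4 ℤ.* (u ℤ.* u)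
        expand = ℤSolver.solve-∀
square-embed mult4 u = multiple 16 (∣ u ∣ * ∣ u ∣) (trans (expand u) (cong (+ 16 ℤ.*_) (square-abs u)))
  where expand : let ev = λ x → + 2 ℤ.* x in ∀ u → ev (ev u) ℤ.* ev (ev u) ≡ + 16 ℤ.* (u ℤ.* u)
        expand = ℤSolver.solve-∀
square-embed odd u = square-od u
square-embed twiceOdd u =
  trans (expand (od u)) (trans (cong (+ 4 ℤ.*_) (square-od u))
    (trans (sym (ℤP.pos-* 4 (8 * tri u + 1))) (cong +_ (distrib (tri u)))))
  where expand : let ev = λ x → + 2 ℤ.* x in ∀ y → ev y ℤ.* ev y ≡ + 4 ℤ.* (y ℤ.* y)
        expand = ℤSolver.solve-∀
        distrib : ∀ t → 4 * (8 * t + 1) ≡ 32 * t + 4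
        distrib = solve-∀


data Refines : Class → Class → Class → Set where
  all-by-parity : Refines all even odd
  even-by-parity : Refines even mult4 twiceOdd

module Form (a b M : ℕ) (a≥1 : 1 ≤ a) (b≥1 : 1 ≤ b) where

  open ≡-Reasoning

  I : ℤ → ℤ → ℤ → ℕ
  I x y z = ind (+ a ℤ.* x ℤ.* x ℤ.+ + (3 * a) ℤ.* y ℤ.* y ℤ.+ + (4 * b) ℤ.* z ℤ.* z ℤ.≟ + M)

  weight : Class → Class → Class → ℕ → ℕ → ℕ → ℕ
  weight k₁ k₂ k₃ X Y Z =
    a * (scale k₁ * X + offset k₁) + 3 * a * (scale k₂ * Y + offset k₂) + 4 * b * (scale k₃ * Z + offset k₃)

  I-embed : ∀ k₁ k₂ k₃ u v w → I (embed k₁ u) (embed k₂ v) (embed k₃ w) ≡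
            ind (weight k₁ k₂ k₃ (size k₁ u) (size k₂ v) (size k₃ w) ≟ M)
  I-embed k₁ k₂ k₃ u v w = ind-iff (_ ℤ.≟ + M) (_ ≟ M)
    (λ e → ℤP.+-injective (trans (sym as-weight) e)) (λ e → trans as-weight (cong +_ e))
    where
    term : ∀ c k u → + c ℤ.* embed k u ℤ.* embed k u ≡ + (c * (scale k * size k u + offset k))
    term c k u = trans (ℤP.*-assoc (+ c) _ _)
      (trans (cong (+ c ℤ.*_) (square-embed k u)) (sym (ℤP.pos-* c _)))
    as-weight : + a ℤ.* embed k₁ u ℤ.* embed k₁ u ℤ.+ + (3 * a) ℤ.* embed k₂ v ℤ.* embed k₂ v
                  ℤ.+ + (4 * b) ℤ.* embed k₃ w ℤ.* embed k₃ w
                ≡ + weight k₁ k₂ k₃ (size k₁ u) (size k₂ v) (size k₃ w)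
    as-weight rewrite term a k₁ u | term (3 * a) k₂ v | term (4 * b) k₃ w = refl

  I-supported : Supported3 M I
  I-supported x y z ne = bound a a≥1 ≤M₁ , bound (3 * a) 3a≥1 ≤M₂ , bound (4 * b) 4b≥1 ≤M₃
    where
    X Y Z : ℕ
    X = ∣ x ∣ * ∣ x ∣
    Y = ∣ y ∣ * ∣ y ∣
    Z = ∣ z ∣ * ∣ z ∣
    W≡M : weight all all all X Y Z ≡ M
    W≡M = ind≢0 (weight all all all X Y Z ≟ M) (λ e → ne (trans (I-embed all all all x y z) e))
    p₁ p₂ p₃ : ℕ
    p₁ = a * (1 * X + 0)
    p₂ = 3 * a * (1 * Y + 0)
    p₃ = 4 * b * (1 * Z + 0)
    ≤M₁ : p₁ ≤ M
    ≤M₁ = subst (p₁ ≤_) W≡M (ℕP.≤-trans (ℕP.m≤m+n p₁ p₂) (ℕP.m≤m+n (p₁ + p₂) p₃))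
    ≤M₂ : p₂ ≤ M
    ≤M₂ = subst (p₂ ≤_) W≡M (ℕP.≤-trans (ℕP.m≤n+m p₂ p₁) (ℕP.m≤m+n (p₁ + p₂) p₃))
    ≤M₃ : p₃ ≤ M
    ≤M₃ = subst (p₃ ≤_) W≡M (ℕP.m≤n+m p₃ (p₁ + p₂))
    3a≥1 : 1 ≤ 3 * a
    3a≥1 = ℕP.≤-trans a≥1 (ℕP.m≤n*m a 3)
    4b≥1 : 1 ≤ 4 * b
    4b≥1 = ℕP.≤-trans b≥1 (ℕP.m≤n*m b 4)
    bound : ∀ {n} c → 1 ≤ c → c * (1 * (n * n) + 0) ≤ M → n ≤ M
    bound {n} c c≥1 le =
      ℕP.≤-trans (n≤k*[n*n] c n c≥1) (subst (λ t → c * t ≤ M) (unit (n * n)) le)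
      where unit : ∀ t → 1 * t + 0 ≡ t
            unit = solve-∀

  -- The working box.  Its size 4M + 4 leaves room for the translations in OddPairs.
  B : ℕ
  B = 4 * M + 4

  M≤B : M ≤ B
  M≤B = ℕP.≤-trans (ℕP.m≤n*m M 4) (ℕP.m≤m+n (4 * M) 4)

  Leaf : Class → Class → Class → ℕ
  Leaf k₁ k₂ k₃ = S3 B (λ u v w → I (embed k₁ u) (embed k₂ v) (embed k₃ w))

  N≡Leaf : N a (3 * a) (4 * b) M ≡ Leaf all all all
  N≡Leaf = begin
      N a (3 * a) (4 * b) M
    ≡⟨ trans (sumZ≡Σz M _) (Σz-cong M (λ x → trans (sumZ≡Σz M _) (Σz-cong M (λ y → sumZ≡Σz M _)))) ⟩
      S3 M I
    ≡⟨ sym (S3-stable M B I I-supported M≤B) ⟩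
      Leaf all all all ∎

  leaf-supported : ∀ k₁ k₂ k₃ → Supported3 B (λ u v w → I (embed k₁ u) (embed k₂ v) (embed k₃ w))
  leaf-supported k₁ k₂ k₃ = Supported3-∘ (embed k₁) (embed k₂) (embed k₃)
    (embed-expanding k₁) (embed-expanding k₂) (embed-expanding k₃) (Supported3-mono I-supported M≤B)

  split₁ : ∀ {k k₀ k₁} → Refines k k₀ k₁ → ∀ k₂ k₃ → Leaf k k₂ k₃ ≡ Leaf k₀ k₂ k₃ + Leaf k₁ k₂ k₃
  split₁ all-by-parity k₂ k₃ = S3-parity₁ B _ (leaf-supported all k₂ k₃)
  split₁ even-by-parity k₂ k₃ = S3-parity₁ B _ (leaf-supported even k₂ k₃)

  split₂ : ∀ {k k₀ k₁} → Refines k k₀ k₁ → ∀ k₁′ k₃ → Leaf k₁′ k k₃ ≡ Leaf k₁′ k₀ k₃ + Leaf k₁′ k₁ k₃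
  split₂ all-by-parity k₁′ k₃ = S3-parity₂ B _ (leaf-supported k₁′ all k₃)
  split₂ even-by-parity k₁′ k₃ = S3-parity₂ B _ (leaf-supported k₁′ even k₃)

  split₃ : ∀ k₁ k₂ → Leaf k₁ k₂ all ≡ Leaf k₁ k₂ even + Leaf k₁ k₂ odd
  split₃ k₁ k₂ = S3-parity₃ B _ (leaf-supported k₁ k₂ all)

  -- The odd-odd leaves are counted twice by the (2 mod 4, 0 mod 4) and
  -- (0 mod 4, 2 mod 4) leaves: OddPairs applied for each fixed z.
  odd-odd : ∀ k₃ → Leaf odd odd k₃ ≡ 2 * (Leaf twiceOdd mult4 k₃ + Leaf mult4 twiceOdd k₃)
  odd-odd k₃ = begin
      Leaf odd odd k₃
    ≡⟨ S3-z-outer B _ ⟩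
      Σz B (λ w → Σz B (λ u → Σz B (λ v → I (od u) (od v) (z w))))
    ≡⟨ Σz-cong B per-z ⟩
      Σz B (λ w → 2 * (Σz B (λ u → Σz B (λ v → I (ev (od u)) (ev (ev v)) (z w)))
                     + Σz B (λ u → Σz B (λ v → I (ev (ev u)) (ev (od v)) (z w)))))
    ≡⟨ Σz-*ˡ B 2 _ ⟩
      2 * Σz B (λ w → Σz B (λ u → Σz B (λ v → I (ev (od u)) (ev (ev v)) (z w)))
                     + Σz B (λ u → Σz B (λ v → I (ev (ev u)) (ev (od v)) (z w))))
    ≡⟨ cong (2 *_) (trans (Σz-+ B _ _) (sym (cong₂ _+_ (S3-z-outer B _) (S3-z-outer B _)))) ⟩
      2 * (Leaf twiceOdd mult4 k₃ + Leaf mult4 twiceOdd k₃) ∎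
    where
    z : ℤ → ℤ
    z = embed k₃
    -- For fixed w, I depends on (x, y) only through x² + 3y².
    g : ℤ → ℤ → ℕ
    g w n = ind (+ a ℤ.* n ℤ.+ + (4 * b) ℤ.* z w ℤ.* z w ℤ.≟ + M)
    through-norm : ∀ x y w → I x y (z w) ≡ g w (norm x y)
    through-norm x y w = cong (λ t → ind (t ℤ.≟ + M))
      (trans (cong (λ c → + a ℤ.* x ℤ.* x ℤ.+ c ℤ.* y ℤ.* y ℤ.+ + (4 * b) ℤ.* z w ℤ.* z w) (ℤP.pos-* 3 a))
             (factor (+ a) x y (+ (4 * b)) (z w)))
      where factor : ∀ A x y C t → A ℤ.* x ℤ.* x ℤ.+ (ℤ.+ 3 ℤ.* A) ℤ.* y ℤ.* y ℤ.+ C ℤ.* t ℤ.* t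
                                   ≡ A ℤ.* (x ℤ.* x ℤ.+ ℤ.+ 3 ℤ.* (y ℤ.* y)) ℤ.+ C ℤ.* t ℤ.* t
            factor = ℤSolver.solve-∀
    per-z : ∀ w → Σz B (λ u → Σz B (λ v → I (od u) (od v) (z w))) ≡
                  2 * (Σz B (λ u → Σz B (λ v → I (ev (od u)) (ev (ev v)) (z w)))
                     + Σz B (λ u → Σz B (λ v → I (ev (ev u)) (ev (od v)) (z w))))
    per-z w = begin
        Σz B (λ u → Σz B (λ v → I (od u) (od v) (z w)))
      ≡⟨ Σz-cong B (λ u → Σz-cong B (λ v → through-norm (od u) (od v) w)) ⟩
        Σz B (λ u → Σz B (λ v → g w (norm (od u) (od v))))
      ≡⟨ OddPairs.odd-pairs (g w) M B bounded ℕP.≤-refl ⟩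
        2 * (Σz B (λ u → Σz B (λ v → g w (norm (ev (od u)) (ev (ev v)))))
           + Σz B (λ u → Σz B (λ v → g w (norm (ev (ev u)) (ev (od v))))))
      ≡⟨ sym (cong (2 *_) (cong₂ _+_
           (Σz-cong B (λ u → Σz-cong B (λ v → through-norm (ev (od u)) (ev (ev v)) w)))
           (Σz-cong B (λ u → Σz-cong B (λ v → through-norm (ev (ev u)) (ev (od v)) w))))) ⟩
        2 * (Σz B (λ u → Σz B (λ v → I (ev (od u)) (ev (ev v)) (z w)))
           + Σz B (λ u → Σz B (λ v → I (ev (ev u)) (ev (od v)) (z w)))) ∎
      where
      bounded : ∀ x y → g w (norm x y) ≢ 0 → ∣ x ∣ ≤ M × ∣ y ∣ ≤ M
      bounded x y ne with I-supported x y (z w) (λ e → ne (trans (sym (through-norm x y w)) e))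
      ... | bx , by , _ = bx , by

  -- N(a, 3a, 4b; M) as a sum over eight class products, for each class of z.
  -- x and y are split to residues mod 4 when even, and the odd-odd part is
  -- rewritten by odd-odd, which is where the multiplicities 3 come from.
  decomposition : ∀ k₃ → Leaf all all k₃ ≡
      Leaf mult4 mult4 k₃ + Leaf twiceOdd twiceOdd k₃
    + 3 * Leaf mult4 twiceOdd k₃ + 3 * Leaf twiceOdd mult4 k₃
    + Leaf mult4 odd k₃ + Leaf twiceOdd odd k₃ + Leaf odd mult4 k₃ + Leaf odd twiceOdd k₃
  decomposition k₃ = begin
      Leaf all all k₃
    ≡⟨ split₁ all-by-parity all k₃ ⟩
      Leaf even all k₃ + Leaf odd all k₃
    ≡⟨ cong₂ _+_ (split₂ all-by-parity even k₃) (split₂ all-by-parity odd k₃) ⟩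
      (Leaf even even k₃ + Leaf even odd k₃) + (Leaf odd even k₃ + Leaf odd odd k₃)
    ≡⟨ cong₂ _+_ (cong₂ _+_ (trans (split₁ even-by-parity even k₃)
                                   (cong₂ _+_ (split₂ even-by-parity mult4 k₃) (split₂ even-by-parity twiceOdd k₃)))
                            (split₁ even-by-parity odd k₃))
                 (cong₂ _+_ (split₂ even-by-parity odd k₃) (odd-odd k₃)) ⟩
      ((mm + mt) + (tm + tt) + (mo + to)) + ((om + ot) + 2 * (tm + mt))
    ≡⟨ collect mm mt tm tt mo to om ot ⟩
      mm + tt + 3 * mt + 3 * tm + mo + to + om + ot ∎
    where
    mm mt tm tt mo to om ot : ℕ
    mm = Leaf mult4 mult4 k₃
    mt = Leaf mult4 twiceOdd k₃
    tm = Leaf twiceOdd mult4 k₃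
    tt = Leaf twiceOdd twiceOdd k₃
    mo = Leaf mult4 odd k₃
    to = Leaf twiceOdd odd k₃
    om = Leaf odd mult4 k₃
    ot = Leaf odd twiceOdd k₃
    collect : ∀ mm mt tm tt mo to om ot →
      ((mm + mt) + (tm + tt) + (mo + to)) + ((om + ot) + 2 * (tm + mt))
        ≡ mm + tt + 3 * mt + 3 * tm + mo + to + om + ot
    collect = solve-∀

  leaves : ∀ k₃ {mm tt mt tm mo to om ot : ℕ} →
    Leaf mult4 mult4 k₃ ≡ mm → Leaf twiceOdd twiceOdd k₃ ≡ tt →
    Leaf mult4 twiceOdd k₃ ≡ mt → Leaf twiceOdd mult4 k₃ ≡ tm →
    Leaf mult4 odd k₃ ≡ mo → Leaf twiceOdd odd k₃ ≡ to →
    Leaf odd mult4 k₃ ≡ om → Leaf odd twiceOdd k₃ ≡ ot →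
    Leaf all all k₃ ≡ mm + tt + 3 * mt + 3 * tm + mo + to + om + ot
  leaves k₃ refl refl refl refl refl refl refl refl = decomposition k₃

  -- A leaf is empty when, for some c, its weights are c·(even) + D while M is
  -- c·(odd) + D, or the other way round.  (The hypotheses spell out
  -- weight k₁ k₂ k₃ X Y Z, so that the ring solver can discharge them.)
  weights-even : ∀ k₁ k₂ k₃ c .{{_ : ℕ.NonZero c}} (P : ℕ → ℕ → ℕ → ℕ) Q D →
    (∀ X Y Z → a * (scale k₁ * X + offset k₁) + 3 * a * (scale k₂ * Y + offset k₂)
               + 4 * b * (scale k₃ * Z + offset k₃) ≡ c * (2 * P X Y Z) + D) →
    M ≡ c * suc (2 * Q) + D → Leaf k₁ k₂ k₃ ≡ 0
  weights-even k₁ k₂ k₃ c P Q D weight≡ M≡ = S3-zero B _ (λ u v w →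
    trans (I-embed k₁ k₂ k₃ u v w) (ind-no (_ ≟ M) (λ e →
      ℕP.even≢odd (P (size k₁ u) (size k₂ v) (size k₃ w)) Q
        (ℕP.*-cancelˡ-≡ _ _ c (ℕP.+-cancelʳ-≡ D _ _
          (trans (sym (weight≡ (size k₁ u) (size k₂ v) (size k₃ w))) (trans e M≡)))))))

  weights-odd : ∀ k₁ k₂ k₃ c .{{_ : ℕ.NonZero c}} (P : ℕ → ℕ → ℕ → ℕ) Q D →
    (∀ X Y Z → a * (scale k₁ * X + offset k₁) + 3 * a * (scale k₂ * Y + offset k₂)
               + 4 * b * (scale k₃ * Z + offset k₃) ≡ c * suc (2 * P X Y Z) + D) →
    M ≡ c * (2 * Q) + D → Leaf k₁ k₂ k₃ ≡ 0
  weights-odd k₁ k₂ k₃ c P Q D weight≡ M≡ = S3-zero B _ (λ u v w →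
    trans (I-embed k₁ k₂ k₃ u v w) (ind-no (_ ≟ M) (λ e →
      ℕP.even≢odd Q (P (size k₁ u) (size k₂ v) (size k₃ w))
        (ℕP.*-cancelˡ-≡ _ _ c (ℕP.+-cancelʳ-≡ D _ _
          (trans (sym M≡) (trans (sym e) (weight≡ (size k₁ u) (size k₂ v) (size k₃ w)))))))))

  leaf-count : ∀ k₁ k₂ k₃ (R : ℕ → ℕ → ℕ → ℕ) n r → M ≡ 8 * n + r →
    (∀ X Y Z → a * (scale k₁ * X + offset k₁) + 3 * a * (scale k₂ * Y + offset k₂)
               + 4 * b * (scale k₃ * Z + offset k₃) ≡ 8 * R X Y Z + r) →
    Leaf k₁ k₂ k₃ ≡ S3 B (λ u v w → ind (R (size k₁ u) (size k₂ v) (size k₃ w) ≟ n))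
  leaf-count k₁ k₂ k₃ R n r M≡ weight≡ = S3-cong B (λ u v w →
    trans (I-embed k₁ k₂ k₃ u v w) (ind-iff (_ ≟ M) (_ ≟ n)
      (λ e → ℕP.*-cancelˡ-≡ _ _ 8 (ℕP.+-cancelʳ-≡ r _ _ (trans (sym (weight≡ _ _ _)) (trans e M≡))))
      (λ e → trans (weight≡ _ _ _) (trans (cong (λ t → 8 * t + r) e) (sym M≡)))))

  n<B : ∀ n r → M ≡ 8 * n + r → n < B
  n<B n r M≡ = ℕP.≤-<-trans n≤M (ℕP.≤-<-trans (ℕP.m≤n*m M 4) (ℕP.m<m+n (4 * M) (s≤s z≤n)))
    where n≤M : n ≤ M
          n≤M = subst (n ≤_) (sym M≡) (ℕP.≤-trans (ℕP.m≤n*m n 8) (ℕP.m≤m+n (8 * n) r))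

  leaf-coefficient : ∀ k₁ k₂ k₃ (R : ℕ → ℕ → ℕ → ℕ) n r {k f} → M ≡ 8 * n + r →
    (∀ X Y Z → a * (scale k₁ * X + offset k₁) + 3 * a * (scale k₂ * Y + offset k₂)
               + 4 * b * (scale k₃ * Z + offset k₃) ≡ 8 * R X Y Z + r) →
    Counts k f ((ℤ¹ ⊗ ℤ¹) ⊗ ℤ¹)
      (λ p → R (size k₁ (proj₁ (proj₁ p))) (size k₂ (proj₂ (proj₁ p))) (size k₃ (proj₂ p))) →
    Leaf k₁ k₂ k₃ ≡ k * f n
  leaf-coefficient k₁ k₂ k₃ R n r M≡ weight≡ counts =
    trans (leaf-count k₁ k₂ k₃ R n r M≡ weight≡) (sym (coefficient counts n B (n<B n r M≡)))

  leaf-coefficient-swapped : ∀ k₁ k₂ k₃ (R : ℕ → ℕ → ℕ → ℕ) n r {k f} → M ≡ 8 * n + r →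
    (∀ X Y Z → a * (scale k₁ * X + offset k₁) + 3 * a * (scale k₂ * Y + offset k₂)
               + 4 * b * (scale k₃ * Z + offset k₃) ≡ 8 * R X Y Z + r) →
    Counts k f ((ℤ¹ ⊗ ℤ¹) ⊗ ℤ¹)
      (λ p → R (size k₁ (proj₂ (proj₁ p))) (size k₂ (proj₁ (proj₁ p))) (size k₃ (proj₂ p))) →
    Leaf k₁ k₂ k₃ ≡ k * f n
  leaf-coefficient-swapped k₁ k₂ k₃ R n r M≡ weight≡ counts =
    trans (leaf-count k₁ k₂ k₃ R n r M≡ weight≡)
          (trans (S3-swap₁₂ B _) (sym (coefficient counts n B (n<B n r M≡))))

-- Leaf names abbreviate the classes of
-- x, y (and z): m = 4u, t = 2(2u + 1), o = 2u + 1, e = 2u.  The form is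
-- instantiated with a and b written out, so that the ring solver sees them as
-- polynomials in a′ and b′; a, b and c are abbreviations for the statements.

-- b = 2b′, M = 8n + 5a: only x odd, y ≡ 2 mod 4 contributes.
module B-even-5a (a′ b′ n : ℕ) (b′≥1 : 1 ≤ b′) where

  a : ℕ
  a = 1 + a′ * 2

  open Form (1 + a′ * 2) (b′ * 2) (8 * n + 5 * (1 + a′ * 2)) (s≤s z≤n) (ℕP.≤-trans b′≥1 (ℕP.m≤m*n b′ 2))

  -- M is odd and 4bz² ≡ 0 mod 8, so everything is decided by x and y: the weight
  -- is even when x, y are both even, ≡ 3a mod 4 when y is odd, and ≡ a mod 8
  -- when x is odd and y ≡ 0 mod 4.  Each empty leaf is witnessed as
  -- weight = c·(2P) + D against M = c·(2Q + 1) + D.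
  mm≡0 : Leaf mult4 mult4 all ≡ 0
  mm≡0 = weights-even mult4 mult4 all 1
    (λ X Y Z → 8 * X + 16 * a′ * X + 24 * Y + 48 * a′ * Y + 4 * b′ * Z) (2 + 4 * n + 5 * a′) 0
    (λ X Y Z → solve (a′ ∷ b′ ∷ X ∷ Y ∷ Z ∷ [])) (solve (n ∷ a′ ∷ b′ ∷ []))
  tt≡0 : Leaf twiceOdd twiceOdd all ≡ 0
  tt≡0 = weights-even twiceOdd twiceOdd all 1
    (λ X Y Z → 16 * X + 32 * a′ * X + 48 * Y + 96 * a′ * Y + 4 * b′ * Z + 8 + 16 * a′) (2 + 4 * n + 5 * a′) 0
    (λ X Y Z → solve (a′ ∷ b′ ∷ X ∷ Y ∷ Z ∷ [])) (solve (n ∷ a′ ∷ b′ ∷ []))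
  mt≡0 : Leaf mult4 twiceOdd all ≡ 0
  mt≡0 = weights-even mult4 twiceOdd all 1
    (λ X Y Z → 8 * X + 16 * a′ * X + 48 * Y + 96 * a′ * Y + 4 * b′ * Z + 6 + 12 * a′) (2 + 4 * n + 5 * a′) 0
    (λ X Y Z → solve (a′ ∷ b′ ∷ X ∷ Y ∷ Z ∷ [])) (solve (n ∷ a′ ∷ b′ ∷ []))
  tm≡0 : Leaf twiceOdd mult4 all ≡ 0
  tm≡0 = weights-even twiceOdd mult4 all 1
    (λ X Y Z → 16 * X + 32 * a′ * X + 24 * Y + 48 * a′ * Y + 4 * b′ * Z + 2 + 4 * a′) (2 + 4 * n + 5 * a′) 0
    (λ X Y Z → solve (a′ ∷ b′ ∷ X ∷ Y ∷ Z ∷ [])) (solve (n ∷ a′ ∷ b′ ∷ []))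
  mo≡0 : Leaf mult4 odd all ≡ 0
  mo≡0 = weights-even mult4 odd all 2
    (λ X Y Z → 4 * X + 8 * a′ * X + 6 * Y + 12 * a′ * Y + 2 * b′ * Z + a′) (2 * n + 2 * a′) (3 + 2 * a′)
    (λ X Y Z → solve (a′ ∷ b′ ∷ X ∷ Y ∷ Z ∷ [])) (solve (n ∷ a′ ∷ b′ ∷ []))
  to≡0 : Leaf twiceOdd odd all ≡ 0
  to≡0 = weights-even twiceOdd odd all 2
    (λ X Y Z → 8 * X + 16 * a′ * X + 6 * Y + 12 * a′ * Y + 2 * b′ * Z + 1 + 3 * a′) (2 * n + 2 * a′) (3 + 2 * a′)
    (λ X Y Z → solve (a′ ∷ b′ ∷ X ∷ Y ∷ Z ∷ [])) (solve (n ∷ a′ ∷ b′ ∷ []))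
  om≡0 : Leaf odd mult4 all ≡ 0
  om≡0 = weights-even odd mult4 all 4
    (λ X Y Z → X + 2 * a′ * X + 6 * Y + 12 * a′ * Y + b′ * Z) (n + a′) (1 + 2 * a′)
    (λ X Y Z → solve (a′ ∷ b′ ∷ X ∷ Y ∷ Z ∷ [])) (solve (n ∷ a′ ∷ b′ ∷ []))

  ot : Leaf odd twiceOdd all ≡ 4 * qpow a (psi a ⊛ psi (12 * a) ⊛ phi b′) n
  ot = leaf-coefficient odd twiceOdd all
    (λ X Y Z → (1 + a′ * 2) * X + 12 * (1 + a′ * 2) * Y + b′ * Z + (1 + a′ * 2)) n (5 * (1 + a′ * 2)) refl
    (λ X Y Z → solve (a′ ∷ b′ ∷ X ∷ Y ∷ Z ∷ []))
    (counts-qpow a (counts-⊛ (counts-⊛ (counts-psi a (s≤s z≤n)) (counts-psi (12 * a) (s≤s z≤n)))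
                             (counts-phi b′ b′≥1)))

  identity : N a (3 * a) (4 * (b′ * 2)) (8 * n + 5 * a) ≡ 4 * qpow a (psi a ⊛ psi (12 * a) ⊛ phi b′) n
  identity = trans N≡Leaf (leaves all mm≡0 tt≡0 mt≡0 tm≡0 mo≡0 to≡0 om≡0 ot)

-- b = 2b′, M = 8n + 7a: only x ≡ 2 mod 4, y odd contributes.
module B-even-7a (a′ b′ n : ℕ) (b′≥1 : 1 ≤ b′) where

  a : ℕ
  a = 1 + a′ * 2

  open Form (1 + a′ * 2) (b′ * 2) (8 * n + 7 * (1 + a′ * 2)) (s≤s z≤n) (ℕP.≤-trans b′≥1 (ℕP.m≤m*n b′ 2))

  -- As for 5a: the weight is even when x, y are both even, ≡ a mod 4 when x is
  -- odd, and ≡ 3a mod 8 when x ≡ 0 mod 4 and y is odd; M ≡ 7a mod 8.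
  mm≡0 : Leaf mult4 mult4 all ≡ 0
  mm≡0 = weights-even mult4 mult4 all 1
    (λ X Y Z → 8 * X + 16 * a′ * X + 24 * Y + 48 * a′ * Y + 4 * b′ * Z) (3 + 4 * n + 7 * a′) 0
    (λ X Y Z → solve (a′ ∷ b′ ∷ X ∷ Y ∷ Z ∷ [])) (solve (n ∷ a′ ∷ b′ ∷ []))
  tt≡0 : Leaf twiceOdd twiceOdd all ≡ 0
  tt≡0 = weights-even twiceOdd twiceOdd all 1
    (λ X Y Z → 16 * X + 32 * a′ * X + 48 * Y + 96 * a′ * Y + 4 * b′ * Z + 8 + 16 * a′) (3 + 4 * n + 7 * a′) 0
    (λ X Y Z → solve (a′ ∷ b′ ∷ X ∷ Y ∷ Z ∷ [])) (solve (n ∷ a′ ∷ b′ ∷ []))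
  mt≡0 : Leaf mult4 twiceOdd all ≡ 0
  mt≡0 = weights-even mult4 twiceOdd all 1
    (λ X Y Z → 8 * X + 16 * a′ * X + 48 * Y + 96 * a′ * Y + 4 * b′ * Z + 6 + 12 * a′) (3 + 4 * n + 7 * a′) 0
    (λ X Y Z → solve (a′ ∷ b′ ∷ X ∷ Y ∷ Z ∷ [])) (solve (n ∷ a′ ∷ b′ ∷ []))
  tm≡0 : Leaf twiceOdd mult4 all ≡ 0
  tm≡0 = weights-even twiceOdd mult4 all 1
    (λ X Y Z → 16 * X + 32 * a′ * X + 24 * Y + 48 * a′ * Y + 4 * b′ * Z + 2 + 4 * a′) (3 + 4 * n + 7 * a′) 0
    (λ X Y Z → solve (a′ ∷ b′ ∷ X ∷ Y ∷ Z ∷ [])) (solve (n ∷ a′ ∷ b′ ∷ []))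
  mo≡0 : Leaf mult4 odd all ≡ 0
  mo≡0 = weights-even mult4 odd all 4
    (λ X Y Z → 2 * X + 4 * a′ * X + 3 * Y + 6 * a′ * Y + b′ * Z) (n + a′) (3 + 6 * a′)
    (λ X Y Z → solve (a′ ∷ b′ ∷ X ∷ Y ∷ Z ∷ [])) (solve (n ∷ a′ ∷ b′ ∷ []))
  om≡0 : Leaf odd mult4 all ≡ 0
  om≡0 = weights-even odd mult4 all 2
    (λ X Y Z → 2 * X + 4 * a′ * X + 12 * Y + 24 * a′ * Y + 2 * b′ * Z) (1 + 2 * n + 3 * a′) (1 + 2 * a′)
    (λ X Y Z → solve (a′ ∷ b′ ∷ X ∷ Y ∷ Z ∷ [])) (solve (n ∷ a′ ∷ b′ ∷ []))
  ot≡0 : Leaf odd twiceOdd all ≡ 0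
  ot≡0 = weights-even odd twiceOdd all 2
    (λ X Y Z → 2 * X + 4 * a′ * X + 24 * Y + 48 * a′ * Y + 2 * b′ * Z + 3 + 6 * a′) (1 + 2 * n + 3 * a′) (1 + 2 * a′)
    (λ X Y Z → solve (a′ ∷ b′ ∷ X ∷ Y ∷ Z ∷ [])) (solve (n ∷ a′ ∷ b′ ∷ []))

  to : Leaf twiceOdd odd all ≡ 4 * (psi (3 * a) ⊛ psi (4 * a) ⊛ phi b′) n
  to = leaf-coefficient-swapped twiceOdd odd all
    (λ X Y Z → 3 * (1 + a′ * 2) * Y + 4 * (1 + a′ * 2) * X + b′ * Z) n (7 * (1 + a′ * 2)) refl
    (λ X Y Z → solve (a′ ∷ b′ ∷ X ∷ Y ∷ Z ∷ []))
    (counts-⊛ (counts-⊛ (counts-psi (3 * a) (s≤s z≤n)) (counts-psi (4 * a) (s≤s z≤n))) (counts-phi b′ b′≥1))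

  identity : N a (3 * a) (4 * (b′ * 2)) (8 * n + 7 * a) ≡ 4 * (psi (3 * a) ⊛ psi (4 * a) ⊛ phi b′) n
  identity = trans N≡Leaf (trans (leaves all mm≡0 tt≡0 mt≡0 tm≡0 mo≡0 to om≡0 ot≡0)
                                 (trans (ℕP.+-identityʳ _) (ℕP.+-identityʳ _)))

-- b = 1 + 2b′, M = 8n: the survivors are x ≡ y ≡ 0 mod 4 or x ≡ y ≡ 2 mod 4 with
-- z even, and x, y ≡ 0, 2 mod 4 in either order with z odd.
module B-odd-0 (a′ b′ n : ℕ) where

  a b c : ℕ
  a = 1 + a′ * 2
  b = 1 + b′ * 2
  c = 1 + (a′ + b′)

  open Form (1 + a′ * 2) (1 + b′ * 2) (8 * n) (s≤s z≤n) (s≤s z≤n)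

  -- M ≡ 0 mod 8.  The weight is odd when x or y is odd; it is ≡ 4 mod 8 when
  -- {x, y} ≡ {0, 2} mod 4 with z even, and when x ≡ y ≡ 0 or 2 mod 4 with z odd:
  -- weight = c·(2P + 1) + D against M = c·(2Q) + D, with c = 1 resp. 4.
  mte≡0 : Leaf mult4 twiceOdd even ≡ 0
  mte≡0 = weights-odd mult4 twiceOdd even 4
    (λ X Y Z → 2 * X + 4 * a′ * X + 12 * Y + 24 * a′ * Y + 2 * Z + 4 * b′ * Z + 1 + 3 * a′) n 0
    (λ X Y Z → solve (a′ ∷ b′ ∷ X ∷ Y ∷ Z ∷ [])) (solve (n ∷ a′ ∷ b′ ∷ []))
  tme≡0 : Leaf twiceOdd mult4 even ≡ 0
  tme≡0 = weights-odd twiceOdd mult4 even 4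
    (λ X Y Z → 4 * X + 8 * a′ * X + 6 * Y + 12 * a′ * Y + 2 * Z + 4 * b′ * Z + a′) n 0
    (λ X Y Z → solve (a′ ∷ b′ ∷ X ∷ Y ∷ Z ∷ [])) (solve (n ∷ a′ ∷ b′ ∷ []))
  moe≡0 : Leaf mult4 odd even ≡ 0
  moe≡0 = weights-odd mult4 odd even 1
    (λ X Y Z → 8 * X + 16 * a′ * X + 12 * Y + 24 * a′ * Y + 8 * Z + 16 * b′ * Z + 1 + 3 * a′) (4 * n) 0
    (λ X Y Z → solve (a′ ∷ b′ ∷ X ∷ Y ∷ Z ∷ [])) (solve (n ∷ a′ ∷ b′ ∷ []))
  toe≡0 : Leaf twiceOdd odd even ≡ 0
  toe≡0 = weights-odd twiceOdd odd even 1
    (λ X Y Z → 16 * X + 32 * a′ * X + 12 * Y + 24 * a′ * Y + 8 * Z + 16 * b′ * Z + 3 + 7 * a′) (4 * n) 0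
    (λ X Y Z → solve (a′ ∷ b′ ∷ X ∷ Y ∷ Z ∷ [])) (solve (n ∷ a′ ∷ b′ ∷ []))
  ome≡0 : Leaf odd mult4 even ≡ 0
  ome≡0 = weights-odd odd mult4 even 1
    (λ X Y Z → 4 * X + 8 * a′ * X + 24 * Y + 48 * a′ * Y + 8 * Z + 16 * b′ * Z + a′) (4 * n) 0
    (λ X Y Z → solve (a′ ∷ b′ ∷ X ∷ Y ∷ Z ∷ [])) (solve (n ∷ a′ ∷ b′ ∷ []))
  ote≡0 : Leaf odd twiceOdd even ≡ 0
  ote≡0 = weights-odd odd twiceOdd even 1
    (λ X Y Z → 4 * X + 8 * a′ * X + 48 * Y + 96 * a′ * Y + 8 * Z + 16 * b′ * Z + 6 + 13 * a′) (4 * n) 0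
    (λ X Y Z → solve (a′ ∷ b′ ∷ X ∷ Y ∷ Z ∷ [])) (solve (n ∷ a′ ∷ b′ ∷ []))
  mmo≡0 : Leaf mult4 mult4 odd ≡ 0
  mmo≡0 = weights-odd mult4 mult4 odd 4
    (λ X Y Z → 2 * X + 4 * a′ * X + 6 * Y + 12 * a′ * Y + 4 * Z + 8 * b′ * Z + b′) n 0
    (λ X Y Z → solve (a′ ∷ b′ ∷ X ∷ Y ∷ Z ∷ [])) (solve (n ∷ a′ ∷ b′ ∷ []))
  tto≡0 : Leaf twiceOdd twiceOdd odd ≡ 0
  tto≡0 = weights-odd twiceOdd twiceOdd odd 4
    (λ X Y Z → 4 * X + 8 * a′ * X + 12 * Y + 24 * a′ * Y + 4 * Z + 8 * b′ * Z + 2 + b′ + 4 * a′) n 0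
    (λ X Y Z → solve (a′ ∷ b′ ∷ X ∷ Y ∷ Z ∷ [])) (solve (n ∷ a′ ∷ b′ ∷ []))
  moo≡0 : Leaf mult4 odd odd ≡ 0
  moo≡0 = weights-odd mult4 odd odd 1
    (λ X Y Z → 8 * X + 16 * a′ * X + 12 * Y + 24 * a′ * Y + 16 * Z + 32 * b′ * Z + 3 + 4 * b′ + 3 * a′) (4 * n) 0
    (λ X Y Z → solve (a′ ∷ b′ ∷ X ∷ Y ∷ Z ∷ [])) (solve (n ∷ a′ ∷ b′ ∷ []))
  too≡0 : Leaf twiceOdd odd odd ≡ 0
  too≡0 = weights-odd twiceOdd odd odd 1
    (λ X Y Z → 16 * X + 32 * a′ * X + 12 * Y + 24 * a′ * Y + 16 * Z + 32 * b′ * Z + 5 + 4 * b′ + 7 * a′) (4 * n) 0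
    (λ X Y Z → solve (a′ ∷ b′ ∷ X ∷ Y ∷ Z ∷ [])) (solve (n ∷ a′ ∷ b′ ∷ []))
  omo≡0 : Leaf odd mult4 odd ≡ 0
  omo≡0 = weights-odd odd mult4 odd 1
    (λ X Y Z → 4 * X + 8 * a′ * X + 24 * Y + 48 * a′ * Y + 16 * Z + 32 * b′ * Z + 2 + 4 * b′ + a′) (4 * n) 0
    (λ X Y Z → solve (a′ ∷ b′ ∷ X ∷ Y ∷ Z ∷ [])) (solve (n ∷ a′ ∷ b′ ∷ []))
  oto≡0 : Leaf odd twiceOdd odd ≡ 0
  oto≡0 = weights-odd odd twiceOdd odd 1
    (λ X Y Z → 4 * X + 8 * a′ * X + 48 * Y + 96 * a′ * Y + 16 * Z + 32 * b′ * Z + 8 + 4 * b′ + 13 * a′) (4 * n) 0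
    (λ X Y Z → solve (a′ ∷ b′ ∷ X ∷ Y ∷ Z ∷ [])) (solve (n ∷ a′ ∷ b′ ∷ []))

  mme : Leaf mult4 mult4 even ≡ 1 * (phi (2 * a) ⊛ phi (6 * a) ⊛ phi (2 * b)) n
  mme = leaf-coefficient mult4 mult4 even
    (λ X Y Z → 2 * (1 + a′ * 2) * X + 6 * (1 + a′ * 2) * Y + 2 * (1 + b′ * 2) * Z) n 0 (sym (ℕP.+-identityʳ _))
    (λ X Y Z → solve (a′ ∷ b′ ∷ X ∷ Y ∷ Z ∷ []))
    (counts-⊛ (counts-⊛ (counts-phi (2 * a) (s≤s z≤n)) (counts-phi (6 * a) (s≤s z≤n)))
              (counts-phi (2 * b) (s≤s z≤n)))

  tte : Leaf twiceOdd twiceOdd even ≡ 4 * qpow (2 * a) (psi (4 * a) ⊛ psi (12 * a) ⊛ phi (2 * b)) n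
  tte = leaf-coefficient twiceOdd twiceOdd even
    (λ X Y Z → 4 * (1 + a′ * 2) * X + 12 * (1 + a′ * 2) * Y + 2 * (1 + b′ * 2) * Z + 2 * (1 + a′ * 2)) n 0 (sym (ℕP.+-identityʳ _))
    (λ X Y Z → solve (a′ ∷ b′ ∷ X ∷ Y ∷ Z ∷ []))
    (counts-qpow (2 * a) (counts-⊛ (counts-⊛ (counts-psi (4 * a) (s≤s z≤n)) (counts-psi (12 * a) (s≤s z≤n)))
                                   (counts-phi (2 * b) (s≤s z≤n))))

  tmo : Leaf twiceOdd mult4 odd ≡ 4 * qpow c (phi (6 * a) ⊛ psi (4 * a) ⊛ psi (4 * b)) n
  tmo = leaf-coefficient-swapped twiceOdd mult4 odd
    (λ X Y Z → 6 * (1 + a′ * 2) * Y + 4 * (1 + a′ * 2) * X + 4 * (1 + b′ * 2) * Z + (1 + (a′ + b′))) n 0 (sym (ℕP.+-identityʳ _))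
    (λ X Y Z → solve (a′ ∷ b′ ∷ X ∷ Y ∷ Z ∷ []))
    (counts-qpow c (counts-⊛ (counts-⊛ (counts-phi (6 * a) (s≤s z≤n)) (counts-psi (4 * a) (s≤s z≤n)))
                             (counts-psi (4 * b) (s≤s z≤n))))

  mto : Leaf mult4 twiceOdd odd ≡ 4 * qpow c (qpow a (phi (2 * a) ⊛ psi (12 * a)) ⊛ psi (4 * b)) n
  mto = leaf-coefficient mult4 twiceOdd odd
    (λ X Y Z → 2 * (1 + a′ * 2) * X + 12 * (1 + a′ * 2) * Y + (1 + a′ * 2) + 4 * (1 + b′ * 2) * Z + (1 + (a′ + b′))) n 0 (sym (ℕP.+-identityʳ _))
    (λ X Y Z → solve (a′ ∷ b′ ∷ X ∷ Y ∷ Z ∷ []))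
    (counts-qpow c (counts-⊛ (counts-qpow a (counts-⊛ (counts-phi (2 * a) (s≤s z≤n)) (counts-psi (12 * a) (s≤s z≤n))))
                             (counts-psi (4 * b) (s≤s z≤n))))

  identity : N a (3 * a) (4 * b) (8 * n) ≡
    (phi (2 * a) ⊛ phi (6 * a) ⊛ phi (2 * b)
     ⊕ 4 · qpow (2 * a) (psi (4 * a) ⊛ psi (12 * a) ⊛ phi (2 * b))
     ⊕ 12 · qpow c ((phi (6 * a) ⊛ psi (4 * a) ⊕ qpow a (phi (2 * a) ⊛ psi (12 * a))) ⊛ psi (4 * b))) n
  identity = begin
      N a (3 * a) (4 * b) (8 * n)
    ≡⟨ trans N≡Leaf (split₃ all all) ⟩
      Leaf all all even + Leaf all all odd
    ≡⟨ cong₂ _+_ (leaves even mme tte mte≡0 tme≡0 moe≡0 toe≡0 ome≡0 ote≡0)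
                 (leaves odd mmo≡0 tto≡0 mto tmo moo≡0 too≡0 omo≡0 oto≡0) ⟩
      (1 * T₁ + 4 * T₂ + 3 * 0 + 3 * 0 + 0 + 0 + 0 + 0) + (0 + 0 + 3 * (4 * Q₂) + 3 * (4 * Q₁) + 0 + 0 + 0 + 0)
    ≡⟨ collect T₁ T₂ Q₁ Q₂ ⟩
      T₁ + 4 * T₂ + 12 * (Q₁ + Q₂)
    ≡⟨ cong (λ t → T₁ + 4 * T₂ + 12 * t) (sym (split-sum c (phi (6 * a) ⊛ psi (4 * a)) (qpow a (phi (2 * a) ⊛ psi (12 * a))) (psi (4 * b)) n)) ⟩
      (phi (2 * a) ⊛ phi (6 * a) ⊛ phi (2 * b)
       ⊕ 4 · qpow (2 * a) (psi (4 * a) ⊛ psi (12 * a) ⊛ phi (2 * b))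
       ⊕ 12 · qpow c ((phi (6 * a) ⊛ psi (4 * a) ⊕ qpow a (phi (2 * a) ⊛ psi (12 * a))) ⊛ psi (4 * b))) n ∎
    where
    open ≡-Reasoning
    T₁ T₂ Q₁ Q₂ : ℕ
    T₁ = (phi (2 * a) ⊛ phi (6 * a) ⊛ phi (2 * b)) n
    T₂ = qpow (2 * a) (psi (4 * a) ⊛ psi (12 * a) ⊛ phi (2 * b)) n
    Q₁ = qpow c (phi (6 * a) ⊛ psi (4 * a) ⊛ psi (4 * b)) n
    Q₂ = qpow c (qpow a (phi (2 * a) ⊛ psi (12 * a)) ⊛ psi (4 * b)) n
    collect : ∀ t₁ t₂ q₁ q₂ → (1 * t₁ + 4 * t₂ + 3 * 0 + 3 * 0 + 0 + 0 + 0 + 0) + (0 + 0 + 3 * (4 * q₂) + 3 * (4 * q₁) + 0 + 0 + 0 + 0)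
                              ≡ t₁ + 4 * t₂ + 12 * (q₁ + q₂)
    collect = solve-∀

-- b = 1 + 2b′, M = 8n + 4: the survivors are x ≡ y ≡ 0 mod 4 or x ≡ y ≡ 2 mod 4 with
-- z odd, and x, y ≡ 0, 2 mod 4 in either order with z even.
module B-odd-4 (a′ b′ n : ℕ) where

  a b : ℕ
  a = 1 + a′ * 2
  b = 1 + b′ * 2

  open Form (1 + a′ * 2) (1 + b′ * 2) (8 * n + 4) (s≤s z≤n) (s≤s z≤n)

  -- M ≡ 4 mod 8.  The weight is odd when x or y is odd; it is ≡ 0 mod 8 when
  -- x ≡ y ≡ 0 or 2 mod 4 with z even, and when {x, y} ≡ {0, 2} mod 4 with z odd:
  -- weight = c·(2P) + D against M = c·(2Q + 1) + D, with c = 1 resp. 4.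
  mme≡0 : Leaf mult4 mult4 even ≡ 0
  mme≡0 = weights-even mult4 mult4 even 4
    (λ X Y Z → 2 * X + 4 * a′ * X + 6 * Y + 12 * a′ * Y + 2 * Z + 4 * b′ * Z) n 0
    (λ X Y Z → solve (a′ ∷ b′ ∷ X ∷ Y ∷ Z ∷ [])) (solve (n ∷ a′ ∷ b′ ∷ []))
  tte≡0 : Leaf twiceOdd twiceOdd even ≡ 0
  tte≡0 = weights-even twiceOdd twiceOdd even 4
    (λ X Y Z → 4 * X + 8 * a′ * X + 12 * Y + 24 * a′ * Y + 2 * Z + 4 * b′ * Z + 2 + 4 * a′) n 0
    (λ X Y Z → solve (a′ ∷ b′ ∷ X ∷ Y ∷ Z ∷ [])) (solve (n ∷ a′ ∷ b′ ∷ []))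
  moe≡0 : Leaf mult4 odd even ≡ 0
  moe≡0 = weights-even mult4 odd even 1
    (λ X Y Z → 8 * X + 16 * a′ * X + 12 * Y + 24 * a′ * Y + 8 * Z + 16 * b′ * Z + 1 + 3 * a′) (1 + 4 * n) 1
    (λ X Y Z → solve (a′ ∷ b′ ∷ X ∷ Y ∷ Z ∷ [])) (solve (n ∷ a′ ∷ b′ ∷ []))
  toe≡0 : Leaf twiceOdd odd even ≡ 0
  toe≡0 = weights-even twiceOdd odd even 1
    (λ X Y Z → 16 * X + 32 * a′ * X + 12 * Y + 24 * a′ * Y + 8 * Z + 16 * b′ * Z + 3 + 7 * a′) (1 + 4 * n) 1
    (λ X Y Z → solve (a′ ∷ b′ ∷ X ∷ Y ∷ Z ∷ [])) (solve (n ∷ a′ ∷ b′ ∷ []))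
  ome≡0 : Leaf odd mult4 even ≡ 0
  ome≡0 = weights-even odd mult4 even 1
    (λ X Y Z → 4 * X + 8 * a′ * X + 24 * Y + 48 * a′ * Y + 8 * Z + 16 * b′ * Z + a′) (1 + 4 * n) 1
    (λ X Y Z → solve (a′ ∷ b′ ∷ X ∷ Y ∷ Z ∷ [])) (solve (n ∷ a′ ∷ b′ ∷ []))
  ote≡0 : Leaf odd twiceOdd even ≡ 0
  ote≡0 = weights-even odd twiceOdd even 1
    (λ X Y Z → 4 * X + 8 * a′ * X + 48 * Y + 96 * a′ * Y + 8 * Z + 16 * b′ * Z + 6 + 13 * a′) (1 + 4 * n) 1
    (λ X Y Z → solve (a′ ∷ b′ ∷ X ∷ Y ∷ Z ∷ [])) (solve (n ∷ a′ ∷ b′ ∷ []))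
  mto≡0 : Leaf mult4 twiceOdd odd ≡ 0
  mto≡0 = weights-even mult4 twiceOdd odd 4
    (λ X Y Z → 2 * X + 4 * a′ * X + 12 * Y + 24 * a′ * Y + 4 * Z + 8 * b′ * Z + 2 + b′ + 3 * a′) n 0
    (λ X Y Z → solve (a′ ∷ b′ ∷ X ∷ Y ∷ Z ∷ [])) (solve (n ∷ a′ ∷ b′ ∷ []))
  tmo≡0 : Leaf twiceOdd mult4 odd ≡ 0
  tmo≡0 = weights-even twiceOdd mult4 odd 4
    (λ X Y Z → 4 * X + 8 * a′ * X + 6 * Y + 12 * a′ * Y + 4 * Z + 8 * b′ * Z + 1 + b′ + a′) n 0
    (λ X Y Z → solve (a′ ∷ b′ ∷ X ∷ Y ∷ Z ∷ [])) (solve (n ∷ a′ ∷ b′ ∷ []))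
  moo≡0 : Leaf mult4 odd odd ≡ 0
  moo≡0 = weights-even mult4 odd odd 1
    (λ X Y Z → 8 * X + 16 * a′ * X + 12 * Y + 24 * a′ * Y + 16 * Z + 32 * b′ * Z + 3 + 4 * b′ + 3 * a′) (1 + 4 * n) 1
    (λ X Y Z → solve (a′ ∷ b′ ∷ X ∷ Y ∷ Z ∷ [])) (solve (n ∷ a′ ∷ b′ ∷ []))
  too≡0 : Leaf twiceOdd odd odd ≡ 0
  too≡0 = weights-even twiceOdd odd odd 1
    (λ X Y Z → 16 * X + 32 * a′ * X + 12 * Y + 24 * a′ * Y + 16 * Z + 32 * b′ * Z + 5 + 4 * b′ + 7 * a′) (1 + 4 * n) 1
    (λ X Y Z → solve (a′ ∷ b′ ∷ X ∷ Y ∷ Z ∷ [])) (solve (n ∷ a′ ∷ b′ ∷ []))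
  omo≡0 : Leaf odd mult4 odd ≡ 0
  omo≡0 = weights-even odd mult4 odd 1
    (λ X Y Z → 4 * X + 8 * a′ * X + 24 * Y + 48 * a′ * Y + 16 * Z + 32 * b′ * Z + 2 + 4 * b′ + a′) (1 + 4 * n) 1
    (λ X Y Z → solve (a′ ∷ b′ ∷ X ∷ Y ∷ Z ∷ [])) (solve (n ∷ a′ ∷ b′ ∷ []))
  oto≡0 : Leaf odd twiceOdd odd ≡ 0
  oto≡0 = weights-even odd twiceOdd odd 1
    (λ X Y Z → 4 * X + 8 * a′ * X + 48 * Y + 96 * a′ * Y + 16 * Z + 32 * b′ * Z + 8 + 4 * b′ + 13 * a′) (1 + 4 * n) 1
    (λ X Y Z → solve (a′ ∷ b′ ∷ X ∷ Y ∷ Z ∷ [])) (solve (n ∷ a′ ∷ b′ ∷ []))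

  mmo : Leaf mult4 mult4 odd ≡ 2 * qpow b′ (phi (2 * a) ⊛ phi (6 * a) ⊛ psi (4 * b)) n
  mmo = leaf-coefficient mult4 mult4 odd
    (λ X Y Z → 2 * (1 + a′ * 2) * X + 6 * (1 + a′ * 2) * Y + 4 * (1 + b′ * 2) * Z + b′) n 4 refl
    (λ X Y Z → solve (a′ ∷ b′ ∷ X ∷ Y ∷ Z ∷ []))
    (counts-qpow b′ (counts-⊛ (counts-⊛ (counts-phi (2 * a) (s≤s z≤n)) (counts-phi (6 * a) (s≤s z≤n)))
                              (counts-psi (4 * b) (s≤s z≤n))))

  tto : Leaf twiceOdd twiceOdd odd ≡ 8 * qpow (2 * a + b′) (psi (4 * a) ⊛ psi (12 * a) ⊛ psi (4 * b)) n
  tto = leaf-coefficient twiceOdd twiceOdd odd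
    (λ X Y Z → 4 * (1 + a′ * 2) * X + 12 * (1 + a′ * 2) * Y + 4 * (1 + b′ * 2) * Z + (2 * (1 + a′ * 2) + b′)) n 4 refl
    (λ X Y Z → solve (a′ ∷ b′ ∷ X ∷ Y ∷ Z ∷ []))
    (counts-qpow (2 * a + b′) (counts-⊛ (counts-⊛ (counts-psi (4 * a) (s≤s z≤n)) (counts-psi (12 * a) (s≤s z≤n)))
                                        (counts-psi (4 * b) (s≤s z≤n))))

  tme : Leaf twiceOdd mult4 even ≡ 2 * qpow a′ (phi (6 * a) ⊛ psi (4 * a) ⊛ phi (2 * b)) n
  tme = leaf-coefficient-swapped twiceOdd mult4 even
    (λ X Y Z → 6 * (1 + a′ * 2) * Y + 4 * (1 + a′ * 2) * X + 2 * (1 + b′ * 2) * Z + a′) n 4 refl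
    (λ X Y Z → solve (a′ ∷ b′ ∷ X ∷ Y ∷ Z ∷ []))
    (counts-qpow a′ (counts-⊛ (counts-⊛ (counts-phi (6 * a) (s≤s z≤n)) (counts-psi (4 * a) (s≤s z≤n)))
                              (counts-phi (2 * b) (s≤s z≤n))))

  mte : Leaf mult4 twiceOdd even ≡ 2 * qpow a′ (qpow a (phi (2 * a) ⊛ psi (12 * a)) ⊛ phi (2 * b)) n
  mte = leaf-coefficient mult4 twiceOdd even
    (λ X Y Z → 2 * (1 + a′ * 2) * X + 12 * (1 + a′ * 2) * Y + (1 + a′ * 2) + 2 * (1 + b′ * 2) * Z + a′) n 4 refl
    (λ X Y Z → solve (a′ ∷ b′ ∷ X ∷ Y ∷ Z ∷ []))
    (counts-qpow a′ (counts-⊛ (counts-qpow a (counts-⊛ (counts-phi (2 * a) (s≤s z≤n)) (counts-psi (12 * a) (s≤s z≤n))))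
                              (counts-phi (2 * b) (s≤s z≤n))))

  identity : N a (3 * a) (4 * b) (8 * n + 4) ≡
    (2 · qpow b′ (phi (2 * a) ⊛ phi (6 * a) ⊛ psi (4 * b))
     ⊕ 8 · qpow (2 * a + b′) (psi (4 * a) ⊛ psi (12 * a) ⊛ psi (4 * b))
     ⊕ 6 · qpow a′ ((phi (6 * a) ⊛ psi (4 * a) ⊕ qpow a (phi (2 * a) ⊛ psi (12 * a))) ⊛ phi (2 * b))) n
  identity = begin
      N a (3 * a) (4 * b) (8 * n + 4)
    ≡⟨ trans N≡Leaf (split₃ all all) ⟩
      Leaf all all even + Leaf all all odd
    ≡⟨ cong₂ _+_ (leaves even mme≡0 tte≡0 mte tme moe≡0 toe≡0 ome≡0 ote≡0)
                 (leaves odd mmo tto mto≡0 tmo≡0 moo≡0 too≡0 omo≡0 oto≡0) ⟩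
      (0 + 0 + 3 * (2 * Q₂) + 3 * (2 * Q₁) + 0 + 0 + 0 + 0) + (2 * T₁ + 8 * T₂ + 3 * 0 + 3 * 0 + 0 + 0 + 0 + 0)
    ≡⟨ collect T₁ T₂ Q₁ Q₂ ⟩
      2 * T₁ + 8 * T₂ + 6 * (Q₁ + Q₂)
    ≡⟨ cong (λ t → 2 * T₁ + 8 * T₂ + 6 * t) (sym (split-sum a′ (phi (6 * a) ⊛ psi (4 * a)) (qpow a (phi (2 * a) ⊛ psi (12 * a))) (phi (2 * b)) n)) ⟩
      (2 · qpow b′ (phi (2 * a) ⊛ phi (6 * a) ⊛ psi (4 * b))
       ⊕ 8 · qpow (2 * a + b′) (psi (4 * a) ⊛ psi (12 * a) ⊛ psi (4 * b))
       ⊕ 6 · qpow a′ ((phi (6 * a) ⊛ psi (4 * a) ⊕ qpow a (phi (2 * a) ⊛ psi (12 * a))) ⊛ phi (2 * b))) n ∎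
    where
    open ≡-Reasoning
    T₁ T₂ Q₁ Q₂ : ℕ
    T₁ = qpow b′ (phi (2 * a) ⊛ phi (6 * a) ⊛ psi (4 * b)) n
    T₂ = qpow (2 * a + b′) (psi (4 * a) ⊛ psi (12 * a) ⊛ psi (4 * b)) n
    Q₁ = qpow a′ (phi (6 * a) ⊛ psi (4 * a) ⊛ phi (2 * b)) n
    Q₂ = qpow a′ (qpow a (phi (2 * a) ⊛ psi (12 * a)) ⊛ phi (2 * b)) n
    collect : ∀ t₁ t₂ q₁ q₂ → (0 + 0 + 3 * (2 * q₂) + 3 * (2 * q₁) + 0 + 0 + 0 + 0) + (2 * t₁ + 8 * t₂ + 3 * 0 + 3 * 0 + 0 + 0 + 0 + 0)
                              ≡ 2 * t₁ + 8 * t₂ + 6 * (q₁ + q₂)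
    collect = solve-∀

parity : ∀ m → Σ ℕ (λ q → m ≡ q * 2) ⊎ Σ ℕ (λ q → m ≡ 1 + q * 2)
parity zero = inj₁ (0 , refl)
parity (suc m) with parity m
... | inj₁ (q , m≡) = inj₂ (q , cong suc m≡)
... | inj₂ (q , m≡) = inj₁ (suc q , cong suc m≡)

odd-not-even : ∀ q → ¬ (2 ∣ 1 + q * 2)
odd-not-even q (divides p e) =
  ℕP.even≢odd p q (trans (ℕP.*-comm 2 p) (trans (sym e) (cong suc (ℕP.*-comm q 2))))

positive-half : ∀ q → 1 ≤ q * 2 → 1 ≤ q
positive-half (suc q) _ = s≤s z≤n

half : ∀ q → q * 2 / 2 ≡ q
half q = m*n/n≡m q 2

mid-odd : ∀ a′ b′ → (1 + a′ * 2 + (1 + b′ * 2)) / 2 ≡ 1 + (a′ + b′)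
mid-odd a′ b′ = trans (cong (_/ 2) (double a′ b′)) (half (1 + (a′ + b′)))
  where double : ∀ a′ b′ → 1 + a′ * 2 + (1 + b′ * 2) ≡ (1 + (a′ + b′)) * 2
        double = solve-∀

lemma4p2 : (a b : ℕ) → 1 ≤ a → 1 ≤ b → ¬ (2 ∣ a) →
    ((2 ∣ b) →
      ((∀ n → N a (3 * a) (4 * b) (8 * n + 5 * a)
          ≡ (4 · qpow a (psi a ⊛ psi (12 * a) ⊛ phi (b / 2))) n)
      × (∀ n → N a (3 * a) (4 * b) (8 * n + 7 * a)
          ≡ (4 · (psi (3 * a) ⊛ psi (4 * a) ⊛ phi (b / 2))) n)))
    × (¬ (2 ∣ b) →
      ((∀ n → N a (3 * a) (4 * b) (8 * n)
          ≡ (phi (2 * a) ⊛ phi (6 * a) ⊛ phi (2 * b)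
             ⊕ 4 · qpow (2 * a) (psi (4 * a) ⊛ psi (12 * a) ⊛ phi (2 * b))
             ⊕ 12 · qpow ((a + b) / 2)
                 ((phi (6 * a) ⊛ psi (4 * a) ⊕ qpow a (phi (2 * a) ⊛ psi (12 * a)))
                  ⊛ psi (4 * b))) n)
      × (∀ n → N a (3 * a) (4 * b) (8 * n + 4)
          ≡ (2 · qpow ((b ∸ 1) / 2) (phi (2 * a) ⊛ phi (6 * a) ⊛ psi (4 * b))
             ⊕ 8 · qpow (2 * a + (b ∸ 1) / 2) (psi (4 * a) ⊛ psi (12 * a) ⊛ psi (4 * b))
             ⊕ 6 · qpow ((a ∸ 1) / 2)
                 ((phi (6 * a) ⊛ psi (4 * a) ⊕ qpow a (phi (2 * a) ⊛ psi (12 * a)))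
                  ⊛ phi (2 * b))) n)))
lemma4p2 a b a≥1 b≥1 a-odd with parity a | parity b
... | inj₁ (q , a≡) | _ = ⊥-elim (a-odd (divides q a≡))
... | inj₂ (a′ , refl) | inj₁ (b′ , refl) rewrite half b′ =
      (λ _ → (λ n → B-even-5a.identity a′ b′ n (positive-half b′ b≥1)) , (λ n → B-even-7a.identity a′ b′ n (positive-half b′ b≥1)))
    , (λ b-odd → ⊥-elim (b-odd (divides b′ refl)))
... | inj₂ (a′ , refl) | inj₂ (b′ , refl) rewrite half b′ | half a′ | mid-odd a′ b′ =
      (λ b-even → ⊥-elim (odd-not-even b′ b-even))
    , (λ _ → (λ n → B-odd-0.identity a′ b′ n) , (λ n → B-odd-4.identity a′ b′ n))
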